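{- For every $1\le k\le n$, \[\mathcal{Q}(\mathcal{Y}^k_n\setminus\mathcal{Y}^{k-1}_n)=s_{(n-k+1,1^{k-1})},\] with the convention $\mathcal{Y}^0_n=\emptyset$.
   Context: Geometric grid classes: for a matrix $M$ with entries in $\{0,1,-1\}$, place a segment of slope $1$ (joining lower-left and upper-right corners) in each unit cell where $M$ has entry $1$ and of slope $-1$ where it has entry $-1$ (rows of $M$ correspond to rows of cells, top to bottom). $\mathcal{G}_n(M)$ is the set of $\pi\in\mathfrak{S}_n$ obtained by placing $n$ points on these segments with no two sharing an $x$- or $y$-coordinate, labeling them $1,\dots,n$ by increasing $y$-coordinate and reading the labels by increasing $x$-coordinate. The $k$-colayered class is $\mathcal{Y}^k_n=\mathcal{G}_n(I_k)$, $I_k$ the $k\times k$ identity matrix. $\mathrm{Des}(\pi)=\{i:\pi(i)>\pi(i+1)\}$; $F_{n,D}=\sum x_{i_1}\cdots x_{i_n}$ over $i_1\le\dots\le i_n$ with $i_j<i_{j+1}$ for $j\in D$; $\mathcal{Q}(A)=\sum_{\pi\in A}F_{n,\mathrm{Des}(\pi)}$; $s_\lambda$ is the Schur function.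
   Formalization: The $n$ points placed on the segments defining $\mathcal{G}_n(M)$, and hence $\mathcal{Y}^k_n$, have rational coordinates. -}

module Defs where

open import Data.Nat as ℕ using (ℕ; zero; suc; _∸_)
open import Data.Fin as Fin using (Fin; toℕ)
open import Data.Fin.Properties using () renaming (_≟_ to _≟F_)
open import Data.Integer using (+_)
open import Data.Rational as ℚ using (ℚ; 0ℚ; 1ℚ; _/_)
open import Data.List using (List; []; _∷_; length; map; concat; replicate)
open import Data.List.Relation.Unary.Unique.Propositional using (Unique)
open import Data.List.Membership.Propositional using (_∈_)
open import Data.Vec using (Vec; lookup; toList)
open import Data.Maybe using (Maybe; just; nothing)
open import Data.Product using (Σ; _×_; _,_)
open import Data.Sum using (_⊎_)
open import Data.Empty using (⊥)
open import Relation.Nullary using (¬_; yes; no)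
open import Relation.Binary.PropositionalEquality using (_≡_; _≢_)
open import Function.Bundles using (_⇔_)

HasCard : {X : Set} → (X → Set) → ℕ → Set
HasCard {X} P c =
  Σ (List X) λ L → Unique L × (∀ x → P x ⇔ (x ∈ L)) × (length L ≡ c)

countFin : ∀ {m} → Fin m → List (Fin m) → ℕ
countFin a [] = 0
countFin a (b ∷ bs) with a ≟F b
... | yes _ = suc (countFin a bs)
... | no  _ = countFin a bs

-- Geometric grid classes.  Matrices with entries in {0,1,-1}.

data Entry : Set where
  zer pos neg : Entry

-- An R × C matrix; rows indexed top to bottom (row 0 is the top row).
Matrix : ℕ → ℕ → Set
Matrix R C = Fin R → Fin C → Entry

I : (k : ℕ) → Matrix k k
I k i j with i ≟F j
... | yes _ = pos
... | no  _ = zer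

ℕtoℚ : ℕ → ℚ
ℕtoℚ a = (+ a) / 1

-- y-coordinate of a point with parameter t on the segment of a cell with
-- entry e whose bottom edge is at height h
segY : Entry → ℚ → ℚ → ℚ
segY pos h t = h ℚ.+ t
segY neg h t = h ℚ.+ (1ℚ ℚ.- t)
segY zer h t = h

-- A placement of n points on the segments of M, points indexed by
-- increasing x-coordinate (point i is the i-th point from the left).
-- Cell (r , c) occupies [c, c+1] × [R-1-r, R-r]; a point in it has
-- x = c + t and y = (R-1-r) + t (entry 1) or (R-1-r) + (1 - t) (entry -1),
-- with 0 ≤ t ≤ 1.
record Placement {R C : ℕ} (M : Matrix R C) (n : ℕ) : Set where
  field
    row : Fin n → Fin R
    col : Fin n → Fin C
    par : Fin n → ℚ
    par-lo : ∀ i → 0ℚ ℚ.≤ par i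
    par-hi : ∀ i → par i ℚ.≤ 1ℚ
    on-segment : ∀ i → M (row i) (col i) ≢ zer

  xc : Fin n → ℚ
  xc i = ℕtoℚ (toℕ (col i)) ℚ.+ par i

  yc : Fin n → ℚ
  yc i = segY (M (row i) (col i)) (ℕtoℚ (R ∸ suc (toℕ (row i)))) (par i)

-- π (one-line notation, 0-based values) lies in G_n(M): there is a placement
-- with strictly increasing x-coordinates (in the indexing order), pairwise
-- distinct y-coordinates, and π(i) = rank of the y-coordinate of point i.
G : ∀ {R C} (M : Matrix R C) (n : ℕ) → Vec (Fin n) n → Set
G M n π = Σ (Placement M n) λ P →
  let open Placement P in
  (∀ i j → i Fin.< j → xc i ℚ.< xc j) ×
  (∀ i j → i ≢ j → (yc i ℚ.< yc j) ⊎ (yc j ℚ.< yc i)) ×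
  (∀ i j → (yc i ℚ.< yc j) ⇔ (lookup π i Fin.< lookup π j))

Y : ℕ → (n : ℕ) → Vec (Fin n) n → Set
Y zero    n π = ⊥
Y (suc k) n π = G (I (suc k)) n π

-- Quasisymmetric expansion: coefficient of the monomial x^α
-- (α : Fin m → ℕ, a monomial in the first m variables x_1..x_m, variable
-- x_{a+1} indexed by a : Fin m).

DesCompatible : ∀ {n m} → Vec (Fin n) n → Vec (Fin m) n → Set
DesCompatible {n} π s = ∀ (i j : Fin n) → toℕ j ≡ suc (toℕ i) →
  (lookup s i Fin.≤ lookup s j) ×
  (lookup π j Fin.< lookup π i → lookup s i Fin.< lookup s j)

HasContent : ∀ {m} → List (Fin m) → (Fin m → ℕ) → Set
HasContent xs α = ∀ a → countFin a xs ≡ α a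

-- terms x_{i_1}⋯x_{i_n} = x^α of Q(A) = Σ_{π∈A} F_{n,Des π}
QTerms : (n : ℕ) → (A : Vec (Fin n) n → Set) → (m : ℕ) → (Fin m → ℕ)
       → Vec (Fin n) n × Vec (Fin m) n → Set
QTerms n A m α (π , s) = A π × DesCompatible π s × HasContent (toList s) α

-- Schur function: semistandard Young tableaux (English notation) given as
-- a list of rows.
_!!_ : {A : Set} → List A → ℕ → Maybe A
[] !! _ = nothing
(x ∷ xs) !! zero = just x
(x ∷ xs) !! suc i = xs !! i

IsSSYT : ∀ {m} → List ℕ → List (List (Fin m)) → Set
IsSSYT {m} λ' T =
  (map length T ≡ λ') ×
  (∀ r c (row : List (Fin m)) (a b : Fin m) → T !! r ≡ just row →
     row !! c ≡ just a → row !! suc c ≡ just b → a Fin.≤ b) ×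
  (∀ r c (row row' : List (Fin m)) (a b : Fin m) → T !! r ≡ just row →
     T !! suc r ≡ just row' → row !! c ≡ just a → row' !! c ≡ just b →
     a Fin.< b)

-- tableaux T contributing x^T = x^α to s_λ
STerms : (λ' : List ℕ) → (m : ℕ) → (Fin m → ℕ) → List (List (Fin m)) → Set
STerms λ' m α T = IsSSYT λ' T × HasContent (concat T) α

hook : ℕ → ℕ → List ℕ
hook n k = suc (n ∸ k) ∷ replicate (k ∸ 1) 1

-- The diagonal segments of I_K descend from the top-left to the bottom-right,
-- so π lies in Y^K_n exactly when it is a skew sum of at most K increasing
-- runs.  Cutting only at descents uses the fewest runs, so Y^k_n ∖ Y^(k-1)_n
-- consists of the permutations of this form with exactly k-1 descents, and
-- each descent set D of size k-1 is realised by exactly one of them: the ranks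
-- are forced by the runs.  Hence Q(Y^k_n ∖ Y^(k-1)_n) is the sum of F_{n,D}
-- over |D| = k-1.  A term of F_{n,D} is a word s, weakly increasing and
-- strictly increasing across D; putting s_1 in the corner of the hook
-- (n-k+1, 1^(k-1)), the letters after a descent in its leg and the others in
-- its arm gives a semistandard tableau with the same content, and arm and leg
-- merge back into s in exactly one compatible way.  So for every monomial x^α
-- both sides have the same (finite) number of terms.
module Submission where

open import Defs
open import Data.Nat using (ℕ; zero; suc; _≤_; _∸_)
open import Data.Fin using (Fin)
open import Data.Product using (Σ; _×_; _,_; proj₁; proj₂)
open import Relation.Nullary using (¬_)

-- Counting below a bound
module Counting where

  open import Data.Nat
  open import Data.Nat.Properties
  open import Data.Product using (_×_; proj₁; proj₂)
  open import Data.Sum using (inj₁; inj₂)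
  open import Data.Unit using (⊤; tt)
  open import Data.Empty using (⊥-elim)
  open import Relation.Nullary using (¬_; Dec; yes; no)
  open import Relation.Unary using (Decidable)
  open import Relation.Binary.PropositionalEquality
  open import Relation.Binary using (tri<; tri≈; tri>)

  indicator : ∀ {A : Set} → Dec A → ℕ
  indicator (yes _) = 1
  indicator (no _) = 0

  countBelow : {P : ℕ → Set} → Decidable P → ℕ → ℕ
  countBelow P? zero = 0
  countBelow P? (suc N) = countBelow P? N + indicator (P? N)

  module _ {P Q : ℕ → Set} (P? : Decidable P) (Q? : Decidable Q) where

    countBelow-mono : ∀ N → (∀ t → t < N → P t → Q t) → countBelow P? N ≤ countBelow Q? N
    countBelow-mono zero h = z≤n
    countBelow-mono (suc N) h with P? N | Q? N
    ... | yes p | yes q = +-monoˡ-≤ 1 (countBelow-mono N (λ t lt → h t (m<n⇒m<1+n lt)))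
    ... | yes p | no q = ⊥-elim (q (h N ≤-refl p))
    ... | no p | yes q = +-mono-≤ (countBelow-mono N (λ t lt → h t (m<n⇒m<1+n lt))) z≤n
    ... | no p | no q = +-monoˡ-≤ 0 (countBelow-mono N (λ t lt → h t (m<n⇒m<1+n lt)))

    countBelow-strict : ∀ N → (∀ t → t < N → P t → Q t) →
      ∀ u → u < N → Q u → ¬ P u → countBelow P? N < countBelow Q? N
    countBelow-strict (suc N) h u u<N qu ¬pu with P? N | Q? N
    ... | yes p | no q = ⊥-elim (q (h N ≤-refl p))
    ... | no p | yes q = m≤n⇒m+0<n+1 (countBelow-mono N (λ t lt → h t (m<n⇒m<1+n lt)))
      where
      m≤n⇒m+0<n+1 : ∀ {a b} → a ≤ b → a + 0 < b + 1
      m≤n⇒m+0<n+1 {a} {b} le rewrite +-identityʳ a | +-comm b 1 = s≤s le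
    ... | yes p | yes q with m≤n⇒m<n∨m≡n (≤-pred u<N)
    ...   | inj₁ lt = +-monoˡ-< 1 (countBelow-strict N (λ t lt → h t (m<n⇒m<1+n lt)) u lt qu ¬pu)
    ...   | inj₂ refl = ⊥-elim (¬pu p)
    countBelow-strict (suc N) h u u<N qu ¬pu | no p | no q with m≤n⇒m<n∨m≡n (≤-pred u<N)
    ...   | inj₁ lt = +-monoˡ-< 0 (countBelow-strict N (λ t lt → h t (m<n⇒m<1+n lt)) u lt qu ¬pu)
    ...   | inj₂ refl = ⊥-elim (q qu)

  countBelow-cong : ∀ {P Q : ℕ → Set} (P? : Decidable P) (Q? : Decidable Q) N →
    (∀ t → t < N → (P t → Q t) × (Q t → P t)) → countBelow P? N ≡ countBelow Q? N
  countBelow-cong P? Q? N h = ≤-antisym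
    (countBelow-mono P? Q? N (λ t lt → proj₁ (h t lt)))
    (countBelow-mono Q? P? N (λ t lt → proj₂ (h t lt)))

  countBelow-all : ∀ N → countBelow {λ _ → ⊤} (λ _ → yes tt) N ≡ N
  countBelow-all zero = refl
  countBelow-all (suc N) = trans (cong (_+ 1) (countBelow-all N)) (+-comm N 1)

  -- Induction on N; when f N takes the top value v', f is redirected to the
  -- value f N on the points that hit v'.
  pigeonhole-countBelow : ∀ {P : ℕ → Set} (P? : Decidable P) N (f : ℕ → ℕ) v →
    (∀ u w → u < N → w < N → P u → P w → f u ≡ f w → u ≡ w) →
    (∀ u → u < N → P u → f u < v) → countBelow P? N ≤ v
  pigeonhole-countBelow P? zero f v inj bnd = z≤n
  pigeonhole-countBelow {P} P? (suc N) f v inj bnd with P? N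
  ... | no pN = subst (_≤ v) (sym (+-identityʳ _))
          (pigeonhole-countBelow P? N f v (λ u w lu lw → inj u w (ltN lu) (ltN lw)) (λ u lu → bnd u (ltN lu)))
    where
    ltN : ∀ {u} → u < N → u < suc N
    ltN = m<n⇒m<1+n
  ... | yes pN with bnd N ≤-refl pN
  ...   | fN<v with v
  ...     | zero = ⊥-elim (n≮0 fN<v)
  ...     | suc v' = subst (_≤ suc v') (+-comm 1 _) (s≤s (pigeonhole-countBelow P? N f' v' inj' bnd'))
    where
    ltN : ∀ {u} → u < N → u < suc N
    ltN = m<n⇒m<1+n
    f' : ℕ → ℕ
    f' u with f u ≟ v'
    ... | yes _ = f N
    ... | no _ = f u
    bnd' : ∀ u → u < N → P u → f' u < v'
    bnd' u lu pu with f u ≟ v'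
    ... | yes e = ≤∧≢⇒< (≤-pred fN<v) (λ e' → <-irrefl (inj u N (ltN lu) ≤-refl pu pN (trans e (sym e'))) lu)
    ... | no ne = ≤∧≢⇒< (≤-pred (bnd u (ltN lu) pu)) ne
    inj' : ∀ u w → u < N → w < N → P u → P w → f' u ≡ f' w → u ≡ w
    inj' u w lu lw pu pw e with f u ≟ v' | f w ≟ v'
    ... | yes e1 | yes e2 = inj u w (ltN lu) (ltN lw) pu pw (trans e1 (sym e2))
    ... | yes e1 | no e2 = ⊥-elim (<-irrefl (inj w N (ltN lw) ≤-refl pw pN (sym e)) lw)
    ... | no e1 | yes e2 = ⊥-elim (<-irrefl (inj u N (ltN lu) ≤-refl pu pN e) lu)
    ... | no e1 | no e2 = inj u w (ltN lu) (ltN lw) pu pw e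

  countBelow-trichotomy : ∀ (f : ℕ → ℕ) v N →
    countBelow (λ u → f u <? v) N + countBelow (λ u → v <? f u) N + countBelow (λ u → f u ≟ v) N ≡ N
  countBelow-trichotomy f v zero = refl
  countBelow-trichotomy f v (suc N) = step (f N <? v) (v <? f N) (f N ≟ v) (countBelow-trichotomy f v N)
    where
    #< = countBelow (λ u → f u <? v) N
    #> = countBelow (λ u → v <? f u) N
    #≡ = countBelow (λ u → f u ≟ v) N
    step : (a : Dec (f N < v)) (b : Dec (v < f N)) (c : Dec (f N ≡ v)) → #< + #> + #≡ ≡ N →
      #< + indicator a + (#> + indicator b) + (#≡ + indicator c) ≡ suc N
    step (yes a) (yes b) _ _ = ⊥-elim (<-asym a b)
    step (yes a) _ (yes c) _ = ⊥-elim (<-irrefl c a)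
    step _ (yes b) (yes c) _ = ⊥-elim (<-irrefl (sym c) b)
    step (yes _) (no _) (no _) ih
      rewrite +-identityʳ #> | +-identityʳ #≡ | +-comm #< 1 = cong suc ih
    step (no _) (yes _) (no _) ih
      rewrite +-identityʳ #< | +-identityʳ #≡ | +-comm #> 1 | +-suc #< #> = cong suc ih
    step (no _) (no _) (yes _) ih
      rewrite +-identityʳ #< | +-identityʳ #> | +-comm #≡ 1 | +-suc (#< + #>) #≡ = cong suc ih
    step (no a) (no b) (no c) _ with <-cmp (f N) v
    ... | tri< x _ _ = ⊥-elim (a x)
    ... | tri≈ _ x _ = ⊥-elim (c x)
    ... | tri> _ _ x = ⊥-elim (b x)

  -- Pigeonhole bounds each of the three counts of countBelow-trichotomy, and
  -- they sum to N, so the first one is exactly f i.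
  injection≡rank : ∀ N (f : ℕ → ℕ) →
    (∀ u w → u < N → w < N → f u ≡ f w → u ≡ w) →
    (∀ u → u < N → f u < N) → ∀ i → i < N → f i ≡ countBelow (λ u → f u <? f i) N
  injection≡rank N f inj bnd i i<N = ≤-antisym fi≤A A≤fi
    where
    A = countBelow (λ u → f u <? f i) N
    B = countBelow (λ u → f i <? f u) N
    C = countBelow (λ u → f u ≟ f i) N
    A≤fi : A ≤ f i
    A≤fi = pigeonhole-countBelow (λ u → f u <? f i) N f (f i) (λ u w lu lw _ _ e → inj u w lu lw e) (λ u _ p → p)
    B≤ : B ≤ N ∸ suc (f i)
    B≤ = pigeonhole-countBelow (λ u → f i <? f u) N (λ u → f u ∸ suc (f i)) (N ∸ suc (f i))
           (λ u w lu lw pu pw e → inj u w lu lw (∸-cancelʳ-≡ pu pw e))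
           (λ u lu p → ∸-monoˡ-< (bnd u lu) p)
    C≤1 : C ≤ 1
    C≤1 = pigeonhole-countBelow (λ u → f u ≟ f i) N (λ _ → 0) 1
           (λ u w lu lw pu pw _ → inj u w lu lw (trans pu (sym pw))) (λ _ _ _ → s≤s z≤n)
    B+ : B + suc (f i) ≤ N
    B+ = subst (B + suc (f i) ≤_) (m∸n+n≡m (bnd i i<N)) (+-monoˡ-≤ (suc (f i)) B≤)
    N≤A+B+1 : N ≤ A + B + 1
    N≤A+B+1 = subst (_≤ A + B + 1) (countBelow-trichotomy f (f i) N) (+-monoʳ-≤ (A + B) C≤1)
    fi≤A : f i ≤ A
    fi≤A = +-cancelʳ-≤ (suc B) (f i) A (subst₂ _≤_ e1 e2 (≤-trans B+ N≤A+B+1))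
      where
      e1 : B + suc (f i) ≡ f i + suc B
      e1 = trans (+-suc B (f i)) (trans (cong suc (+-comm B (f i))) (sym (+-suc (f i) B)))
      e2 : A + B + 1 ≡ A + suc B
      e2 = trans (+-assoc A B 1) (cong (A +_) (+-comm B 1))

-- The colayered permutation with prescribed descents
module Runs where

  open import Data.Nat
  open import Data.Nat.Properties
  open import Data.Bool using (Bool; true; false)
  open import Data.List using (List; []; _∷_; length)
  open import Data.Product using (_×_; _,_; proj₁; proj₂)
  open import Data.Sum using (_⊎_; inj₁; inj₂)
  open import Data.Unit using (tt)
  open import Data.Empty using (⊥-elim)
  open import Relation.Nullary using (¬_; Dec; does; yes; no)
  open import Relation.Nullary.Decidable using (_⊎-dec_; _×-dec_; _→-dec_; map′)
  open import Relation.Unary using (Decidable)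
  open import Relation.Binary.PropositionalEquality
  open import Relation.Binary using (tri<; tri≈; tri>)
  open Counting

  bit : Bool → ℕ
  bit true = 1
  bit false = 0

  -- bs marks with true the positions t at which a descent occurs between t
  -- and t+1; runIndex bs t counts the marks before t, i.e. it is the index of
  -- the run containing t.
  markAt : List Bool → ℕ → Bool
  markAt [] _ = false
  markAt (b ∷ bs) zero = b
  markAt (b ∷ bs) (suc t) = markAt bs t

  runIndex : List Bool → ℕ → ℕ
  runIndex bs zero = 0
  runIndex [] (suc t) = 0
  runIndex (b ∷ bs) (suc t) = bit b + runIndex bs t

  runIndex-suc : ∀ bs t → runIndex bs (suc t) ≡ runIndex bs t + bit (markAt bs t)
  runIndex-suc [] zero = refl
  runIndex-suc [] (suc t) = refl
  runIndex-suc (b ∷ bs) zero = +-comm (bit b) 0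
  runIndex-suc (b ∷ bs) (suc t) = trans (cong (bit b +_) (runIndex-suc bs t)) (sym (+-assoc (bit b) _ _))

  runIndex-marked : ∀ bs t → markAt bs t ≡ true → runIndex bs (suc t) ≡ suc (runIndex bs t)
  runIndex-marked bs t e = trans (runIndex-suc bs t) (trans (cong (λ b → runIndex bs t + bit b) e) (+-comm _ 1))

  runIndex-unmarked : ∀ bs t → markAt bs t ≡ false → runIndex bs (suc t) ≡ runIndex bs t
  runIndex-unmarked bs t e = trans (runIndex-suc bs t) (trans (cong (λ b → runIndex bs t + bit b) e) (+-identityʳ _))

  runIndex-≤-suc : ∀ bs t → runIndex bs t ≤ runIndex bs (suc t)
  runIndex-≤-suc bs t = subst (runIndex bs t ≤_) (sym (runIndex-suc bs t)) (m≤m+n _ _)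

  runIndex-mono : ∀ bs {t t'} → t ≤ t' → runIndex bs t ≤ runIndex bs t'
  runIndex-mono bs le = go (≤⇒≤′ le)
    where
    go : ∀ {t t'} → t ≤′ t' → runIndex bs t ≤ runIndex bs t'
    go ≤′-refl = ≤-refl
    go (≤′-step p) = ≤-trans (go p) (runIndex-≤-suc bs _)

  -- In the colayered permutation with descent marks bs, position u gets a
  -- smaller value than t: u lies in a later run, or in the same run further left.
  Below : List Bool → ℕ → ℕ → Set
  Below bs u t = (runIndex bs t < runIndex bs u) ⊎ (runIndex bs u ≡ runIndex bs t × u < t)

  Below? : ∀ bs t → Decidable (λ u → Below bs u t)
  Below? bs t u = (runIndex bs t <? runIndex bs u) ⊎-dec ((runIndex bs u ≟ runIndex bs t) ×-dec (u <? t))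

  Below-irrefl : ∀ bs u → ¬ Below bs u u
  Below-irrefl bs u (inj₁ x) = <-irrefl refl x
  Below-irrefl bs u (inj₂ (_ , x)) = <-irrefl refl x

  Below-trans : ∀ bs {a b c} → Below bs a b → Below bs b c → Below bs a c
  Below-trans bs (inj₁ x) (inj₁ y) = inj₁ (<-trans y x)
  Below-trans bs {a} (inj₁ x) (inj₂ (e , _)) = inj₁ (subst (_< runIndex bs a) e x)
  Below-trans bs {a} {b} {c} (inj₂ (e , _)) (inj₁ y) = inj₁ (subst (runIndex bs c <_) (sym e) y)
  Below-trans bs (inj₂ (e , x)) (inj₂ (e' , y)) = inj₂ (trans e e' , <-trans x y)

  Below-total : ∀ bs u t → u ≢ t → Below bs u t ⊎ Below bs t u
  Below-total bs u t ne with <-cmp (runIndex bs t) (runIndex bs u)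
  ... | tri< x _ _ = inj₁ (inj₁ x)
  ... | tri> _ _ x = inj₂ (inj₁ x)
  ... | tri≈ _ e _ with <-cmp u t
  ...   | tri< x _ _ = inj₁ (inj₂ (sym e , x))
  ...   | tri≈ _ x _ = ⊥-elim (ne x)
  ...   | tri> _ _ x = inj₂ (inj₂ (e , x))

  Below-suc⇒marked : ∀ bs t → Below bs (suc t) t → markAt bs t ≡ true
  Below-suc⇒marked bs t (inj₂ (_ , t+1<t)) = ⊥-elim (<-asym t+1<t (n<1+n t))
  Below-suc⇒marked bs t (inj₁ lt) with markAt bs t in e
  ... | true = refl
  ... | false = ⊥-elim (<-irrefl (sym (runIndex-unmarked bs t e)) lt)

  marked⇒Below-suc : ∀ bs t → markAt bs t ≡ true → Below bs (suc t) t
  marked⇒Below-suc bs t e = inj₁ (subst (runIndex bs t <_) (sym (runIndex-marked bs t e)) (n<1+n _))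

  colayered : List Bool → ℕ → ℕ → ℕ
  colayered bs N t = countBelow (Below? bs t) N

  colayered-strict : ∀ bs N u t → u < N → Below bs u t → colayered bs N u < colayered bs N t
  colayered-strict bs N u t u<N r =
    countBelow-strict (Below? bs u) (Below? bs t) N (λ x _ rx → Below-trans bs rx r) u u<N r (Below-irrefl bs u)

  colayered< : ∀ bs N t → t < N → colayered bs N t < N
  colayered< bs N t t<N = subst (colayered bs N t <_) (countBelow-all N)
    (countBelow-strict (Below? bs t) (λ _ → yes tt) N (λ _ _ _ → tt) t t<N tt (Below-irrefl bs t))

  colayered-<⇒Below : ∀ bs N u t → t < N → colayered bs N u < colayered bs N t → Below bs u t
  colayered-<⇒Below bs N u t t<N lt with u ≟ t
  ... | yes refl = ⊥-elim (<-irrefl refl lt)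
  ... | no ne with Below-total bs u t ne
  ...   | inj₁ r = r
  ...   | inj₂ r = ⊥-elim (<-asym lt (colayered-strict bs N t u t<N r))

  colayered-injective : ∀ bs N u t → u < N → t < N → colayered bs N u ≡ colayered bs N t → u ≡ t
  colayered-injective bs N u t u<N t<N e with u ≟ t
  ... | yes x = x
  ... | no ne with Below-total bs u t ne
  ...   | inj₁ r = ⊥-elim (<-irrefl e (colayered-strict bs N u t u<N r))
  ...   | inj₂ r = ⊥-elim (<-irrefl (sym e) (colayered-strict bs N t u t<N r))

  descentMarks : (ℕ → ℕ) → ℕ → List Bool
  descentMarks P zero = []
  descentMarks P (suc M) = does (P 1 <? P 0) ∷ descentMarks (λ t → P (suc t)) M

  length-descentMarks : ∀ P M → length (descentMarks P M) ≡ M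
  length-descentMarks P zero = refl
  length-descentMarks P (suc M) = cong suc (length-descentMarks _ M)

  markAt-descentMarks : ∀ P M t → t < M → markAt (descentMarks P M) t ≡ does (P (suc t) <? P t)
  markAt-descentMarks P (suc M) zero lt = refl
  markAt-descentMarks P (suc M) (suc t) (s≤s lt) = markAt-descentMarks (λ t → P (suc t)) M t lt

  markAt-ext : ∀ (xs ys : List Bool) → length xs ≡ length ys →
    (∀ t → t < length xs → markAt xs t ≡ markAt ys t) → xs ≡ ys
  markAt-ext [] [] e h = refl
  markAt-ext (x ∷ xs) (y ∷ ys) e h =
    cong₂ _∷_ (h 0 (s≤s z≤n)) (markAt-ext xs ys (suc-injective e) (λ t lt → h (suc t) (s≤s lt)))

  does-≡ : ∀ {A : Set} (a? : Dec A) (b : Bool) → (A → b ≡ true) → (b ≡ true → A) → does a? ≡ b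
  does-≡ (yes a) true _ _ = refl
  does-≡ (yes a) false to _ = sym (to a)
  does-≡ (no ¬a) true _ from = ⊥-elim (¬a (from refl))
  does-≡ (no ¬a) false _ _ = refl

  does≡true⇒ : ∀ {A : Set} (a? : Dec A) → does a? ≡ true → A
  does≡true⇒ (yes a) _ = a
  does≡true⇒ (no _) ()

  descentMarks-colayered : ∀ bs n' → length bs ≡ n' → descentMarks (colayered bs (suc n')) n' ≡ bs
  descentMarks-colayered bs n' e = markAt-ext _ _ (trans (length-descentMarks _ n') (sym e)) marks≡
    where
    N = suc n'
    marks≡ : ∀ t → t < length (descentMarks (colayered bs N) n') → markAt (descentMarks (colayered bs N) n') t ≡ markAt bs t
    marks≡ t lt' = trans (markAt-descentMarks (colayered bs N) n' t lt)
      (does-≡ (colayered bs N (suc t) <? colayered bs N t) (markAt bs t)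
        (λ c → Below-suc⇒marked bs t (colayered-<⇒Below bs N (suc t) t (m<n⇒m<1+n lt) c))
        (λ m → colayered-strict bs N (suc t) t (s≤s lt) (marked⇒Below-suc bs t m)))
      where
      lt : t < n'
      lt = subst (t <_) (length-descentMarks _ n') lt'

  InjectiveBelow : (ℕ → ℕ) → ℕ → Set
  InjectiveBelow P N = ∀ u w → u < N → w < N → P u ≡ P w → u ≡ w

  ColayeredBy : List Bool → (ℕ → ℕ) → ℕ → Set
  ColayeredBy bs P N = ∀ i i' → i < i' → i' < N →
    (P i < P i' → runIndex bs i ≡ runIndex bs i') × (runIndex bs i ≡ runIndex bs i' → P i < P i')

  ColayeredBy⇒<⇔Below : ∀ bs P N → InjectiveBelow P N → ColayeredBy bs P N → ∀ u t → u < N → t < N →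
    (P u < P t → Below bs u t) × (Below bs u t → P u < P t)
  ColayeredBy⇒<⇔Below bs P N inj col u t u<N t<N with <-cmp u t
  ... | tri< ut _ _ = (λ lt → inj₂ (proj₁ (col u t ut t<N) lt , ut)) , from
    where
    from : Below bs u t → P u < P t
    from (inj₁ x) = ⊥-elim (<⇒≱ x (runIndex-mono bs (<⇒≤ ut)))
    from (inj₂ (e , _)) = proj₂ (col u t ut t<N) e
  ... | tri≈ _ refl _ = (λ lt → ⊥-elim (<-irrefl refl lt)) , λ r → ⊥-elim (Below-irrefl bs u r)
  ... | tri> _ _ tu = to , from
    where
    to : P u < P t → Below bs u t
    to lt with runIndex bs t ≟ runIndex bs u
    ... | yes e = ⊥-elim (<-asym lt (proj₂ (col t u tu u<N) e))
    ... | no ne = inj₁ (≤∧≢⇒< (runIndex-mono bs (<⇒≤ tu)) ne)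
    from : Below bs u t → P u < P t
    from (inj₂ (_ , x)) = ⊥-elim (<-asym x tu)
    from (inj₁ x) with <-cmp (P u) (P t)
    ... | tri< y _ _ = y
    ... | tri≈ _ y _ = ⊥-elim (<-irrefl (sym (inj u t u<N t<N y)) tu)
    ... | tri> _ _ y = ⊥-elim (<-irrefl (proj₁ (col t u tu u<N) y) x)

  InjectiveBelow-resp : ∀ {P Q N} → (∀ t → t < N → P t ≡ Q t) → InjectiveBelow P N → InjectiveBelow Q N
  InjectiveBelow-resp P≗Q inj u w lu lw e = inj u w lu lw (trans (P≗Q u lu) (trans e (sym (P≗Q w lw))))

  ColayeredBy-resp : ∀ {bs P Q N} → (∀ t → t < N → P t ≡ Q t) → ColayeredBy bs P N → ColayeredBy bs Q N
  ColayeredBy-resp P≗Q col i i' lt lt' =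
    (λ q → proj₁ (col i i' lt lt') (subst₂ _<_ (sym (P≗Q i li)) (sym (P≗Q i' lt')) q)) ,
    (λ e → subst₂ _<_ (P≗Q i li) (P≗Q i' lt') (proj₂ (col i i' lt lt') e))
    where li = <-trans lt lt'

  InjectiveBelow? : ∀ P N → Dec (InjectiveBelow P N)
  InjectiveBelow? P N = map′ (λ h u w lu lw → h {u} lu {w} lw) (λ h {u} lu {w} lw → h u w lu lw)
    (allUpTo? (λ u → allUpTo? (λ w → (P u ≟ P w) →-dec (u ≟ w)) N) N)

  ColayeredBy? : ∀ bs P N → Dec (ColayeredBy bs P N)
  ColayeredBy? bs P N = map′ (λ h i i' i<i' i'<N → h {i'} i'<N {i} i<i') (λ h {i'} i'<N {i} i<i' → h i i' i<i' i'<N)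
    (allUpTo? (λ i' → allUpTo? (λ i →
       ((P i <? P i') →-dec (runIndex bs i ≟ runIndex bs i')) ×-dec
       ((runIndex bs i ≟ runIndex bs i') →-dec (P i <? P i'))) i') N)

  ColayeredBy⇒colayered : ∀ bs P N → InjectiveBelow P N → ColayeredBy bs P N → (∀ u → u < N → P u < N) →
    ∀ t → t < N → P t ≡ colayered bs N t
  ColayeredBy⇒colayered bs P N inj col bnd t t<N = trans (injection≡rank N P inj bnd t t<N)
    (countBelow-cong (λ u → P u <? P t) (Below? bs t) N (λ u u<N → ColayeredBy⇒<⇔Below bs P N inj col u t u<N t<N))

  colayered-ColayeredBy : ∀ bs N → ColayeredBy bs (colayered bs N) N
  colayered-ColayeredBy bs N i i' i<i' i'<N =
    (λ lt → sameRun (colayered-<⇒Below bs N i i' i'<N lt)) ,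
    (λ e → colayered-strict bs N i i' (<-trans i<i' i'<N) (inj₂ (e , i<i')))
    where
    sameRun : Below bs i i' → runIndex bs i ≡ runIndex bs i'
    sameRun (inj₁ x) = ⊥-elim (<⇒≱ x (runIndex-mono bs (<⇒≤ i<i')))
    sameRun (inj₂ (e , _)) = e

-- Fractions with a common denominator
module RationalBounds where

  open import Data.Nat using (suc; _<_; _≤_)
  import Data.Nat.Properties as ℕP
  open import Data.Integer as ℤ using (+_)
  import Data.Integer.Properties as ℤP
  open import Data.Rational as ℚ using (ℚ; 0ℚ; 1ℚ; _/_; toℚᵘ; fromℚᵘ)
  import Data.Rational.Properties as ℚP
  import Data.Rational.Unnormalised as U
  import Data.Rational.Unnormalised.Properties as UP
  open import Relation.Binary.PropositionalEquality

  fromℚᵘ-mono-< : ∀ {p q} → p U.< q → fromℚᵘ p ℚ.< fromℚᵘ q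
  fromℚᵘ-mono-< {p} {q} p<q = ℚP.toℚᵘ-cancel-<
    (UP.<-respˡ-≃ (UP.≃-sym (ℚP.toℚᵘ-fromℚᵘ p)) (UP.<-respʳ-≃ (UP.≃-sym (ℚP.toℚᵘ-fromℚᵘ q)) p<q))

  fromℚᵘ-mono-≤ : ∀ {p q} → p U.≤ q → fromℚᵘ p ℚ.≤ fromℚᵘ q
  fromℚᵘ-mono-≤ {p} {q} p≤q = ℚP.toℚᵘ-cancel-≤
    (UP.≤-respˡ-≃ (UP.≃-sym (ℚP.toℚᵘ-fromℚᵘ p)) (UP.≤-respʳ-≃ (UP.≃-sym (ℚP.toℚᵘ-fromℚᵘ q)) p≤q))

  frac-< : ∀ {a b} d → a < b → (+ a) / suc d ℚ.< (+ b) / suc d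
  frac-< {a} {b} d lt = fromℚᵘ-mono-< {U.mkℚᵘ (+ a) d} {U.mkℚᵘ (+ b) d} (U.*<* (ℤP.*-monoʳ-<-pos (+ suc d) (ℤ.+<+ lt)))

  frac-≤ : ∀ {a b} d → a ≤ b → (+ a) / suc d ℚ.≤ (+ b) / suc d
  frac-≤ {a} {b} d le = fromℚᵘ-mono-≤ {U.mkℚᵘ (+ a) d} {U.mkℚᵘ (+ b) d} (U.*≤* (ℤP.*-monoʳ-≤-nonNeg (+ suc d) (ℤ.+≤+ le)))

  frac≤1 : ∀ {a} d → a ≤ suc d → (+ a) / suc d ℚ.≤ 1ℚ
  frac≤1 {a} d le = fromℚᵘ-mono-≤ {U.mkℚᵘ (+ a) d} {U.1ℚᵘ}
    (U.*≤* (subst₂ ℤ._≤_ (sym (ℤP.*-identityʳ (+ a))) (sym (ℤP.*-identityˡ (+ suc d))) (ℤ.+≤+ le)))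

  0<frac : ∀ {a} d → 0 < a → 0ℚ ℚ.< (+ a) / suc d
  0<frac {a} d lt = fromℚᵘ-mono-< {U.0ℚᵘ} {U.mkℚᵘ (+ a) d}
    (U.*<* (subst₂ ℤ._<_ (sym (ℤP.*-zeroˡ (+ suc d))) (sym (ℤP.*-identityʳ (+ a))) (ℤ.+<+ lt)))

  ℕtoℚ-mono-≤ : ∀ {a b} → a ≤ b → ℕtoℚ a ℚ.≤ ℕtoℚ b
  ℕtoℚ-mono-≤ = frac-≤ 0

  ℕtoℚ-suc : ∀ a → ℕtoℚ (suc a) ≡ ℕtoℚ a ℚ.+ 1ℚ
  ℕtoℚ-suc a = ℚP.toℚᵘ-injective (begin
    toℚᵘ (ℕtoℚ (suc a))                   ≈⟨ ℚP.toℚᵘ-fromℚᵘ (U.mkℚᵘ (+ suc a) 0) ⟩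
    U.mkℚᵘ (+ suc a) 0                    ≈⟨ UP.≃-sym a+1≃ ⟩
    U.mkℚᵘ (+ a) 0 U.+ U.1ℚᵘ              ≈⟨ UP.+-cong (UP.≃-sym (ℚP.toℚᵘ-fromℚᵘ (U.mkℚᵘ (+ a) 0))) UP.≃-refl ⟩
    toℚᵘ (ℕtoℚ a) U.+ toℚᵘ 1ℚ             ≈⟨ UP.≃-sym (ℚP.toℚᵘ-homo-+ (ℕtoℚ a) 1ℚ) ⟩
    toℚᵘ (ℕtoℚ a ℚ.+ 1ℚ)                  ∎)
    where
    open UP.≃-Reasoning
    a+1≃ : U.mkℚᵘ (+ a) 0 U.+ U.1ℚᵘ U.≃ U.mkℚᵘ (+ suc a) 0
    a+1≃ = U.*≡* (cong (ℤ._* (+ 1)) (trans (cong (ℤ._+ (+ 1)) (ℤP.*-identityʳ (+ a)))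
                   (trans (sym (ℤP.pos-+ a 1)) (cong +_ (ℕP.+-comm a 1)))))

-- Placements on the diagonal of I_K
module DiagonalPlacements where

  open import Data.Nat using (ℕ; suc; z≤n; s≤s; _<_; _≤_; _∸_; _<?_)
  import Data.Nat.Properties as ℕP
  open import Data.Fin as Fin using (Fin; toℕ; fromℕ<)
  import Data.Fin.Properties as FP
  open import Data.Integer using (+_)
  open import Data.Rational as ℚ using (ℚ; 0ℚ; 1ℚ; _/_)
  import Data.Rational.Properties as ℚP
  open import Data.Vec using (Vec; lookup)
  open import Data.Product using (_×_; _,_; proj₁; proj₂)
  open import Data.Sum using (_⊎_; inj₁; inj₂)
  open import Data.Empty using (⊥-elim)
  open import Relation.Nullary using (¬_; yes; no)
  open import Relation.Binary using (tri<; tri≈; tri>)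
  open import Relation.Binary.PropositionalEquality
  open import Function.Bundles using (_⇔_; mk⇔; Equivalence)
  open RationalBounds

  I≢zer⇒≡ : ∀ K (a b : Fin K) → I K a b ≢ zer → a ≡ b
  I≢zer⇒≡ K a b ne with a FP.≟ b
  ... | yes e = e
  ... | no _ = ⊥-elim (ne refl)

  I-diagonal : ∀ K (a : Fin K) → I K a a ≡ pos
  I-diagonal K a with a FP.≟ a
  ... | yes _ = refl
  ... | no ne = ⊥-elim (ne refl)

  segY-diagonal : ∀ K (r c : Fin K) t → r ≡ c →
    segY (I K r c) (ℕtoℚ (K ∸ suc (toℕ r))) t ≡ ℕtoℚ (K ∸ suc (toℕ c)) ℚ.+ t
  segY-diagonal K r .r t refl rewrite I-diagonal K r = refl

  ℚ<⇒≱ : ∀ {p q : ℚ} → p ℚ.< q → ¬ (q ℚ.≤ p)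
  ℚ<⇒≱ lt le = ℚP.<-irrefl refl (ℚP.<-≤-trans lt le)

  ℕtoℚ+frac≤ : ∀ {a' a : ℕ} {t' : ℚ} → a' < a → t' ℚ.≤ 1ℚ → ℕtoℚ a' ℚ.+ t' ℚ.≤ ℕtoℚ a
  ℕtoℚ+frac≤ {a'} {a} {t'} lt t'≤1 = begin
    ℕtoℚ a' ℚ.+ t'  ≤⟨ ℚP.+-monoʳ-≤ (ℕtoℚ a') t'≤1 ⟩
    ℕtoℚ a' ℚ.+ 1ℚ  ≡⟨ ℕtoℚ-suc a' ⟨
    ℕtoℚ (suc a')   ≤⟨ ℕtoℚ-mono-≤ lt ⟩
    ℕtoℚ a          ∎
    where open ℚP.≤-Reasoning

  cell-≤ : ∀ {a' a : ℕ} {t t' : ℚ} → a' < a → 0ℚ ℚ.≤ t → t' ℚ.≤ 1ℚ → ℕtoℚ a' ℚ.+ t' ℚ.≤ ℕtoℚ a ℚ.+ t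
  cell-≤ {a = a} lt 0≤t t'≤1 = ℚP.≤-trans (ℕtoℚ+frac≤ lt t'≤1)
    (subst (ℚ._≤ ℕtoℚ a ℚ.+ _) (ℚP.+-identityʳ (ℕtoℚ a)) (ℚP.+-monoʳ-≤ (ℕtoℚ a) 0≤t))

  cell-< : ∀ {a' a : ℕ} {t t' : ℚ} → a' < a → 0ℚ ℚ.< t → t' ℚ.≤ 1ℚ → ℕtoℚ a' ℚ.+ t' ℚ.< ℕtoℚ a ℚ.+ t
  cell-< {a = a} lt 0<t t'≤1 = ℚP.≤-<-trans (ℕtoℚ+frac≤ lt t'≤1)
    (subst (ℚ._< ℕtoℚ a ℚ.+ _) (ℚP.+-identityʳ (ℕtoℚ a)) (ℚP.+-monoʳ-< (ℕtoℚ a) 0<t))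

  height-antitone : ∀ {K c c'} → c < c' → c' < K → K ∸ suc c' < K ∸ suc c
  height-antitone {K} lt lt' = ℕP.∸-monoʳ-< (s≤s lt) lt'

  -- The column of each point of a placement on the segments of I_K; two
  -- points share a cell exactly when they form an ascent of π.
  record DiagonalColumns (K n : ℕ) (π : Vec (Fin n) n) : Set where
    field
      col : Fin n → ℕ
      bnd : ∀ i → col i < K
      mono : ∀ i i' → toℕ i < toℕ i' → col i ≤ col i'
      ord : ∀ i i' → toℕ i < toℕ i' →
        (toℕ (lookup π i) < toℕ (lookup π i') → col i ≡ col i') ×
        (col i ≡ col i' → toℕ (lookup π i) < toℕ (lookup π i'))
      inj : ∀ i i' → lookup π i ≡ lookup π i' → i ≡ i'

  G⇒DiagonalColumns : ∀ K n π → G (I K) n π → DiagonalColumns K n π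
  G⇒DiagonalColumns K n π (P , xinc , ydis , yiff) =
    record { col = c ; bnd = bnd ; mono = mono ; ord = ord ; inj = inj }
    where
    open Placement P
    c : Fin n → ℕ
    c i = toℕ (col i)
    bnd : ∀ i → c i < K
    bnd i = FP.toℕ<n (col i)
    h : Fin n → ℕ
    h i = K ∸ suc (c i)
    yeq : ∀ i → yc i ≡ ℕtoℚ (h i) ℚ.+ par i
    yeq i = segY-diagonal K (row i) (col i) (par i) (I≢zer⇒≡ K _ _ (on-segment i))
    mono : ∀ i i' → toℕ i < toℕ i' → c i ≤ c i'
    mono i i' lt with c i' <? c i
    ... | no nlt = ℕP.≮⇒≥ nlt
    ... | yes lt' = ⊥-elim (ℚ<⇒≱ (xinc i i' lt) (cell-≤ lt' (par-lo i) (par-hi i')))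
    sameColumn⇒par< : ∀ i i' → toℕ i < toℕ i' → c i ≡ c i' → par i ℚ.< par i'
    sameColumn⇒par< i i' lt e with par i ℚ.<? par i'
    ... | yes p<p' = p<p'
    ... | no p≮p' = ⊥-elim (ℚ<⇒≱ (xinc i i' lt)
            (subst (λ z → ℕtoℚ z ℚ.+ par i' ℚ.≤ ℕtoℚ (c i) ℚ.+ par i) e (ℚP.+-monoʳ-≤ (ℕtoℚ (c i)) (ℚP.≮⇒≥ p≮p'))))
    ord : ∀ i i' → toℕ i < toℕ i' →
      (toℕ (lookup π i) < toℕ (lookup π i') → c i ≡ c i') × (c i ≡ c i' → toℕ (lookup π i) < toℕ (lookup π i'))
    ord i i' lt = to , from
      where
      from : c i ≡ c i' → toℕ (lookup π i) < toℕ (lookup π i')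
      from e = Equivalence.to (yiff i i') (subst₂ ℚ._<_ (sym (yeq i)) (sym (yeq i'))
        (subst (λ z → ℕtoℚ (K ∸ suc z) ℚ.+ par i ℚ.< ℕtoℚ (h i') ℚ.+ par i') (sym e)
          (ℚP.+-monoʳ-< (ℕtoℚ (h i')) (sameColumn⇒par< i i' lt e))))
      to : toℕ (lookup π i) < toℕ (lookup π i') → c i ≡ c i'
      to asc with ℕP.m≤n⇒m<n∨m≡n (mono i i' lt)
      ... | inj₂ e = e
      ... | inj₁ c<c' = ⊥-elim (ℚ<⇒≱ (Equivalence.from (yiff i i') asc)
              (subst₂ ℚ._≤_ (sym (yeq i')) (sym (yeq i)) (cell-≤ (height-antitone c<c' (bnd i')) (par-lo i) (par-hi i'))))
    inj : ∀ i i' → lookup π i ≡ lookup π i' → i ≡ i'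
    inj i i' e with i FP.≟ i'
    ... | yes i≡i' = i≡i'
    ... | no i≢i' with ydis i i' i≢i'
    ...   | inj₁ y = ⊥-elim (ℕP.<-irrefl (cong toℕ e) (Equivalence.to (yiff i i') y))
    ...   | inj₂ y = ⊥-elim (ℕP.<-irrefl (cong toℕ (sym e)) (Equivalence.to (yiff i' i) y))

  module HeightOrder {K n : ℕ} {π : Vec (Fin n) n} (cw : DiagonalColumns K n π) (yc : Fin n → ℚ)
    (sameColumn-< : ∀ i i' → DiagonalColumns.col cw i ≡ DiagonalColumns.col cw i' → toℕ i < toℕ i' → yc i ℚ.< yc i')
    (laterColumn-< : ∀ i i' → DiagonalColumns.col cw i' < DiagonalColumns.col cw i → yc i ℚ.< yc i') where
    open DiagonalColumns cw renaming (col to c)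

    ydis : ∀ i j → i ≢ j → (yc i ℚ.< yc j) ⊎ (yc j ℚ.< yc i)
    ydis i j ne with ℕP.<-cmp (c i) (c j)
    ... | tri< x _ _ = inj₂ (laterColumn-< j i x)
    ... | tri> _ _ x = inj₁ (laterColumn-< i j x)
    ... | tri≈ _ e _ with ℕP.<-cmp (toℕ i) (toℕ j)
    ...   | tri< x _ _ = inj₁ (sameColumn-< i j e x)
    ...   | tri≈ _ x _ = ⊥-elim (ne (FP.toℕ-injective x))
    ...   | tri> _ _ x = inj₂ (sameColumn-< j i (sym e) x)
    yiff : ∀ i j → (yc i ℚ.< yc j) ⇔ (lookup π i Fin.< lookup π j)
    yiff i j with ℕP.<-cmp (toℕ i) (toℕ j)
    ... | tri< lt _ _ = mk⇔ to from
      where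
      to : yc i ℚ.< yc j → lookup π i Fin.< lookup π j
      to y with ℕP.m≤n⇒m<n∨m≡n (mono i j lt)
      ... | inj₂ e = proj₂ (ord i j lt) e
      ... | inj₁ x = ⊥-elim (ℚP.<-asym y (laterColumn-< j i x))
      from : lookup π i Fin.< lookup π j → yc i ℚ.< yc j
      from p = sameColumn-< i j (proj₁ (ord i j lt) p) lt
    ... | tri≈ _ e _ rewrite FP.toℕ-injective e =
      mk⇔ (λ y → ⊥-elim (ℚP.<-irrefl refl y)) (λ p → ⊥-elim (ℕP.<-irrefl refl p))
    ... | tri> _ _ gt = mk⇔ to from
      where
      to : yc i ℚ.< yc j → lookup π i Fin.< lookup π j
      to y with ℕP.<-cmp (toℕ (lookup π i)) (toℕ (lookup π j))
      ... | tri< x _ _ = x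
      ... | tri≈ _ x _ = ⊥-elim (ℕP.<-irrefl (sym (cong toℕ (inj i j (FP.toℕ-injective x)))) gt)
      ... | tri> _ _ x = ⊥-elim (ℚP.<-asym y (sameColumn-< j i (proj₁ (ord j i gt) x) gt))
      from : lookup π i Fin.< lookup π j → yc i ℚ.< yc j
      from p with ℕP.m≤n⇒m<n∨m≡n (mono j i gt)
      ... | inj₁ x = laterColumn-< i j x
      ... | inj₂ e = ⊥-elim (ℕP.<-asym p (proj₂ (ord j i gt) e))

  -- Point i is placed at parameter (i+1)/n on the diagonal segment of its
  -- column, so x increases with i, and so does y inside one cell.
  DiagonalColumns⇒G : ∀ K n' π → DiagonalColumns K (suc n') π → G (I K) (suc n') π
  DiagonalColumns⇒G K n' π cw = P , xinc , ydis , yiff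
    where
    open DiagonalColumns cw renaming (col to c)
    n = suc n'
    fc : Fin n → Fin K
    fc i = fromℕ< (bnd i)
    fce : ∀ i → toℕ (fc i) ≡ c i
    fce i = FP.toℕ-fromℕ< (bnd i)
    t : Fin n → ℚ
    t i = (+ suc (toℕ i)) / suc n'
    t-pos : ∀ i → 0ℚ ℚ.< t i
    t-pos i = 0<frac {suc (toℕ i)} n' (s≤s z≤n)
    t-le : ∀ i → t i ℚ.≤ 1ℚ
    t-le i = frac≤1 {suc (toℕ i)} n' (FP.toℕ<n i)
    P : Placement (I K) n
    P = record { row = fc ; col = fc ; par = t ; par-lo = λ i → ℚP.<⇒≤ (t-pos i) ; par-hi = t-le
               ; on-segment = λ i → subst (_≢ zer) (sym (I-diagonal K (fc i))) λ () }
    open Placement P using (xc; yc)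
    h : Fin n → ℕ
    h i = K ∸ suc (c i)
    xeq : ∀ i → xc i ≡ ℕtoℚ (c i) ℚ.+ t i
    xeq i = cong (λ z → ℕtoℚ z ℚ.+ t i) (fce i)
    yeq : ∀ i → yc i ≡ ℕtoℚ (h i) ℚ.+ t i
    yeq i = trans (segY-diagonal K (fc i) (fc i) (t i) refl) (cong (λ z → ℕtoℚ (K ∸ suc z) ℚ.+ t i) (fce i))
    xinc : ∀ i j → i Fin.< j → xc i ℚ.< xc j
    xinc i j lt = subst₂ ℚ._<_ (sym (xeq i)) (sym (xeq j))
      (ℚP.+-mono-≤-< (ℕtoℚ-mono-≤ (mono i j lt)) (frac-< {suc (toℕ i)} {suc (toℕ j)} n' (s≤s lt)))
    sameColumn-< : ∀ i i' → c i ≡ c i' → toℕ i < toℕ i' → yc i ℚ.< yc i'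
    sameColumn-< i i' e lt = subst₂ ℚ._<_ (sym (yeq i)) (sym (yeq i'))
      (subst (λ z → ℕtoℚ (K ∸ suc z) ℚ.+ t i ℚ.< ℕtoℚ (h i') ℚ.+ t i') (sym e)
        (ℚP.+-monoʳ-< (ℕtoℚ (h i')) (frac-< {suc (toℕ i)} {suc (toℕ i')} n' (s≤s lt))))
    laterColumn-< : ∀ i i' → c i' < c i → yc i ℚ.< yc i'
    laterColumn-< i i' lt = subst₂ ℚ._<_ (sym (yeq i)) (sym (yeq i'))
      (cell-< (height-antitone lt (bnd i)) (t-pos i') (t-le i))
    open HeightOrder cw yc sameColumn-< laterColumn-<

-- The colayered classes
module ColayeredClass where

  open import Data.Nat
  open import Data.Nat.Properties
  open import Data.Fin using (Fin; toℕ; fromℕ<)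
  import Data.Fin.Properties as FP
  open import Data.Vec using (Vec; lookup; tabulate)
  import Data.Vec.Properties as VP
  open import Data.Bool using (Bool; true; false)
  open import Data.List using (List; _∷_; length)
  open import Data.Product using (_×_; _,_; proj₁; proj₂)
  open import Data.Sum using (inj₁; inj₂)
  open import Data.Empty using (⊥-elim)
  open import Relation.Nullary using (¬_; Dec; does; yes; no)
  open import Relation.Nullary.Decidable using (dec-true; dec-false; _×-dec_)
  open import Relation.Binary using (tri<; tri≈; tri>)
  open import Relation.Binary.PropositionalEquality
  open Counting
  open Runs
  open DiagonalPlacements

  mono-by-steps : ∀ (c : ℕ → ℕ) N → (∀ t → suc t < N → c t ≤ c (suc t)) → ∀ i i' → i ≤ i' → i' < N → c i ≤ c i'
  mono-by-steps c N st i zero z≤n _ = ≤-refl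
  mono-by-steps c N st i (suc i') le lt with m≤n⇒m<n∨m≡n le
  ... | inj₂ refl = ≤-refl
  ... | inj₁ (s≤s le') = ≤-trans (mono-by-steps c N st i i' le' (<-trans (n<1+n i') lt)) (st i' lt)

  -- c is monotone, so c i ≡ c i' makes it constant between i and i'.
  ≡-by-steps : ∀ (c d : ℕ → ℕ) N → (∀ t → suc t < N → c t ≤ c (suc t)) →
    (∀ t → suc t < N → c t ≡ c (suc t) → d t ≡ d (suc t)) →
    ∀ i i' → i ≤ i' → i' < N → c i ≡ c i' → d i ≡ d i'
  ≡-by-steps c d N cm st i zero z≤n _ _ = refl
  ≡-by-steps c d N cm st i (suc i') le lt e with m≤n⇒m<n∨m≡n le
  ... | inj₂ refl = refl
  ... | inj₁ (s≤s le') = trans (≡-by-steps c d N cm st i i' le' lt' e1) (st i' lt (trans (sym e1) e))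
    where
    lt' : i' < N
    lt' = <-trans (n<1+n i') lt
    e1 : c i ≡ c i'
    e1 = ≤-antisym (mono-by-steps c N cm i i' le' lt') (subst (c i' ≤_) (sym e) (cm i' lt))

  extendℕ : ∀ {n} → (Fin n → ℕ) → ℕ → ℕ
  extendℕ {n} f t with t <? n
  ... | yes p = f (fromℕ< p)
  ... | no _ = 0

  extendℕ-< : ∀ {n} (f : Fin n → ℕ) t (lt : t < n) → extendℕ f t ≡ f (fromℕ< lt)
  extendℕ-< {n} f t lt with t <? n
  ... | yes p = cong f (FP.toℕ-injective (trans (FP.toℕ-fromℕ< p) (sym (FP.toℕ-fromℕ< lt))))
  ... | no np = ⊥-elim (np lt)

  extendℕ-toℕ : ∀ {n} (f : Fin n → ℕ) i → extendℕ f (toℕ i) ≡ f i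
  extendℕ-toℕ f i = trans (extendℕ-< f (toℕ i) (FP.toℕ<n i)) (cong f (FP.fromℕ<-toℕ i (FP.toℕ<n i)))

  valuesℕ : ∀ {n} → Vec (Fin n) n → ℕ → ℕ
  valuesℕ π = extendℕ (λ i → toℕ (lookup π i))

  descents : ∀ {n'} → Vec (Fin (suc n')) (suc n') → List Bool
  descents {n'} π = descentMarks (valuesℕ π) n'

  numDescents : ∀ {n'} → Vec (Fin (suc n')) (suc n') → ℕ
  numDescents {n'} π = runIndex (descents π) n'

  Colayered : ∀ n' → Vec (Fin (suc n')) (suc n') → Set
  Colayered n' π = InjectiveBelow (valuesℕ π) (suc n') × ColayeredBy (descents π) (valuesℕ π) (suc n')

  module FromColumns {K n'} (π : Vec (Fin (suc n')) (suc n')) (cw : DiagonalColumns K (suc n') π) where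
    open DiagonalColumns cw
    n = suc n'
    P = valuesℕ π
    bs = descents π
    c = extendℕ col
    Pe : ∀ t (lt : t < n) → P t ≡ toℕ (lookup π (fromℕ< lt))
    Pe t lt = extendℕ-< (λ i → toℕ (lookup π i)) t lt
    ce : ∀ t (lt : t < n) → c t ≡ col (fromℕ< lt)
    ce t lt = extendℕ-< col t lt
    fe : ∀ t (lt : t < n) → toℕ (fromℕ< lt) ≡ t
    fe t lt = FP.toℕ-fromℕ< lt
    monoN : ∀ i i' → i < i' → i' < n → c i ≤ c i'
    monoN i i' lt lt' = subst₂ _≤_ (sym (ce i li)) (sym (ce i' lt')) (mono _ _ (subst₂ _<_ (sym (fe i li)) (sym (fe i' lt')) lt))
      where li = <-trans lt lt'
    ordN : ∀ i i' → i < i' → i' < n → (P i < P i' → c i ≡ c i') × (c i ≡ c i' → P i < P i')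
    ordN i i' lt lt' =
      (λ p → trans (ce i li) (trans (proj₁ o (subst₂ _<_ (Pe i li) (Pe i' lt') p)) (sym (ce i' lt')))) ,
      (λ e → subst₂ _<_ (sym (Pe i li)) (sym (Pe i' lt')) (proj₂ o (trans (sym (ce i li)) (trans e (ce i' lt')))))
      where
      li = <-trans lt lt'
      o : (toℕ (lookup π (fromℕ< li)) < toℕ (lookup π (fromℕ< lt')) → col (fromℕ< li) ≡ col (fromℕ< lt')) ×
          (col (fromℕ< li) ≡ col (fromℕ< lt') → toℕ (lookup π (fromℕ< li)) < toℕ (lookup π (fromℕ< lt')))
      o = ord (fromℕ< li) (fromℕ< lt') (subst₂ _<_ (sym (fe i li)) (sym (fe i' lt')) lt)
    injN : InjectiveBelow P n
    injN u w lu lw e = trans (sym (fe u lu))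
      (trans (cong toℕ (inj _ _ (FP.toℕ-injective (trans (sym (Pe u lu)) (trans e (Pe w lw)))))) (fe w lw))

    c-step : ∀ t → suc t < n → c t ≤ c (suc t)
    c-step t lt = monoN t (suc t) (n<1+n t) lt
    ascent⇒unmarked : ∀ t → suc t < n → P t < P (suc t) → markAt bs t ≡ false
    ascent⇒unmarked t lt asc = trans (markAt-descentMarks P n' t (≤-pred lt)) (dec-false (P (suc t) <? P t) (<-asym asc))
    descent⇒marked : ∀ t → suc t < n → P (suc t) < P t → markAt bs t ≡ true
    descent⇒marked t lt des = trans (markAt-descentMarks P n' t (≤-pred lt)) (dec-true (P (suc t) <? P t) des)
    sameColumn⇒sameRun : ∀ t → suc t < n → c t ≡ c (suc t) → runIndex bs t ≡ runIndex bs (suc t)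
    sameColumn⇒sameRun t lt e = sym (runIndex-unmarked bs t (ascent⇒unmarked t lt (proj₂ (ordN t (suc t) (n<1+n t) lt) e)))
    sameRun⇒sameColumn : ∀ t → suc t < n → runIndex bs t ≡ runIndex bs (suc t) → c t ≡ c (suc t)
    sameRun⇒sameColumn t lt e with <-cmp (P t) (P (suc t))
    ... | tri< asc _ _ = proj₁ (ordN t (suc t) (n<1+n t) lt) asc
    ... | tri≈ _ eq _ = ⊥-elim (<-irrefl (injN t (suc t) (<-trans (n<1+n t) lt) lt eq) (n<1+n t))
    ... | tri> _ _ des = ⊥-elim (1+n≢n (sym (trans e (runIndex-marked bs t (descent⇒marked t lt des)))))
    colN : ColayeredBy bs P n
    colN i i' lt lt' =
      (λ p → ≡-by-steps c (runIndex bs) n c-step sameColumn⇒sameRun i i' (<⇒≤ lt) lt' (proj₁ (ordN i i' lt lt') p)) ,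
      (λ e → proj₂ (ordN i i' lt lt') (≡-by-steps (runIndex bs) c n (λ t _ → runIndex-≤-suc bs t) sameRun⇒sameColumn i i' (<⇒≤ lt) lt' e))

    -- Every descent moves to a later column.
    runIndex+c₀≤c : ∀ t → t < n → runIndex bs t + c 0 ≤ c t
    runIndex+c₀≤c zero _ = ≤-refl
    runIndex+c₀≤c (suc t) lt with markAt bs t in m
    ... | false = subst (λ z → z + c 0 ≤ c (suc t)) (sym (runIndex-unmarked bs t m))
                    (≤-trans (runIndex+c₀≤c t (<-trans (n<1+n t) lt)) (c-step t lt))
    ... | true = subst (λ z → z + c 0 ≤ c (suc t)) (sym (runIndex-marked bs t m))
                   (≤-trans (s≤s (runIndex+c₀≤c t (<-trans (n<1+n t) lt))) (≤∧≢⇒< (c-step t lt) newColumn))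
      where
      newColumn : c t ≢ c (suc t)
      newColumn e = 1+n≢n (sym (trans (sameColumn⇒sameRun t lt e) (runIndex-marked bs t m)))
    numDescents<K : numDescents π < K
    numDescents<K = ≤-<-trans (≤-trans (m≤m+n _ _) (runIndex+c₀≤c n' ≤-refl)) (subst (_< K) (sym (ce n' ≤-refl)) (bnd _))

  DiagonalColumns⇒Colayered : ∀ {K n'} (π : Vec (Fin (suc n')) (suc n')) → DiagonalColumns K (suc n') π →
    Colayered n' π × numDescents π < K
  DiagonalColumns⇒Colayered π cw = (injN , colN) , numDescents<K
    where open FromColumns π cw

  Colayered⇒DiagonalColumns : ∀ {K n'} (π : Vec (Fin (suc n')) (suc n')) →
    Colayered n' π → numDescents π < K → DiagonalColumns K (suc n') π
  Colayered⇒DiagonalColumns π (inj , col) b = record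
    { col = λ i → runIndex (descents π) (toℕ i)
    ; bnd = λ i → ≤-<-trans (runIndex-mono (descents π) (≤-pred (FP.toℕ<n i))) b
    ; mono = λ i i' lt → runIndex-mono (descents π) (<⇒≤ lt)
    ; ord = λ i i' lt →
        (λ p → proj₁ (col _ _ lt (FP.toℕ<n i')) (subst₂ _<_ (sym (extendℕ-toℕ _ i)) (sym (extendℕ-toℕ _ i')) p)) ,
        (λ e → subst₂ _<_ (extendℕ-toℕ _ i) (extendℕ-toℕ _ i') (proj₂ (col _ _ lt (FP.toℕ<n i')) e))
    ; inj = λ i i' e → FP.toℕ-injective (inj _ _ (FP.toℕ<n i) (FP.toℕ<n i')
        (trans (extendℕ-toℕ _ i) (trans (cong toℕ e) (sym (extendℕ-toℕ _ i')))))
    }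

  Colayered⇒Y : ∀ j n' π → Colayered n' π → numDescents π < j → Y j (suc n') π
  Colayered⇒Y zero n' π col ()
  Colayered⇒Y (suc j) n' π col b = DiagonalColumns⇒G (suc j) n' π (Colayered⇒DiagonalColumns π col b)

  Y⇒Colayered : ∀ j n' π → Y j (suc n') π → Colayered n' π × numDescents π < j
  Y⇒Colayered zero n' π ()
  Y⇒Colayered (suc j) n' π y = DiagonalColumns⇒Colayered π (G⇒DiagonalColumns (suc j) (suc n') π y)

  ExactlyColayered : ℕ → ∀ n' → Vec (Fin (suc n')) (suc n') → Set
  ExactlyColayered k n' π = Colayered n' π × numDescents π ≡ k ∸ 1

  ExactlyColayered? : ∀ k n' π → Dec (ExactlyColayered k n' π)
  ExactlyColayered? k n' π =
    (InjectiveBelow? (valuesℕ π) (suc n') ×-dec ColayeredBy? (descents π) (valuesℕ π) (suc n')) ×-dec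
    (numDescents π ≟ k ∸ 1)

  Ydiff⇒ExactlyColayered : ∀ k n' π → 1 ≤ k → Y k (suc n') π × ¬ Y (k ∸ 1) (suc n') π → ExactlyColayered k n' π
  Ydiff⇒ExactlyColayered (suc k') n' π _ (y , ¬y) with Y⇒Colayered (suc k') n' π y
  ... | col , b = col , ≤-antisym (≤-pred b) (≮⇒≥ (λ lt → ¬y (Colayered⇒Y k' n' π col lt)))

  ExactlyColayered⇒Ydiff : ∀ k n' π → 1 ≤ k → ExactlyColayered k n' π → Y k (suc n') π × ¬ Y (k ∸ 1) (suc n') π
  ExactlyColayered⇒Ydiff (suc k') n' π _ (col , e) =
    Colayered⇒Y (suc k') n' π col (subst (_< suc k') (sym e) ≤-refl) ,
    λ y → <-irrefl e (proj₂ (Y⇒Colayered k' n' π y))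

  valuesℕ< : ∀ {n} (π : Vec (Fin n) n) u → u < n → valuesℕ π u < n
  valuesℕ< π u lu = subst (_< _) (sym (extendℕ-< _ u lu)) (FP.toℕ<n _)

  colayeredFin : ∀ n' → List Bool → Fin (suc n') → Fin (suc n')
  colayeredFin n' bs i = fromℕ< (colayered< bs (suc n') (toℕ i) (FP.toℕ<n i))

  colayeredVec : ∀ n' → List Bool → Vec (Fin (suc n')) (suc n')
  colayeredVec n' bs = tabulate (colayeredFin n' bs)

  valuesℕ-colayeredVec : ∀ n' bs t → t < suc n' → valuesℕ (colayeredVec n' bs) t ≡ colayered bs (suc n') t
  valuesℕ-colayeredVec n' bs t lt = begin
    valuesℕ (colayeredVec n' bs) t                    ≡⟨ extendℕ-< _ t lt ⟩
    toℕ (lookup (colayeredVec n' bs) (fromℕ< lt))     ≡⟨ cong toℕ (VP.lookup∘tabulate (colayeredFin n' bs) (fromℕ< lt)) ⟩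
    toℕ (colayeredFin n' bs (fromℕ< lt))              ≡⟨ FP.toℕ-fromℕ< _ ⟩
    colayered bs (suc n') (toℕ (fromℕ< lt))           ≡⟨ cong (colayered bs (suc n')) (FP.toℕ-fromℕ< lt) ⟩
    colayered bs (suc n') t                           ∎
    where open ≡-Reasoning

  descentMarks-cong : ∀ (P Q : ℕ → ℕ) M → (∀ t → t ≤ M → P t ≡ Q t) → descentMarks P M ≡ descentMarks Q M
  descentMarks-cong P Q zero h = refl
  descentMarks-cong P Q (suc M) h =
    cong₂ _∷_ (cong₂ (λ a b → does (a <? b)) (h 1 (s≤s z≤n)) (h 0 z≤n)) (descentMarks-cong _ _ M (λ t lt → h (suc t) (s≤s lt)))

  descents-colayeredVec : ∀ n' bs → length bs ≡ n' → descents (colayeredVec n' bs) ≡ bs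
  descents-colayeredVec n' bs e =
    trans (descentMarks-cong _ _ n' (λ t lt → valuesℕ-colayeredVec n' bs t (s≤s lt))) (descentMarks-colayered bs n' e)

  colayeredVec-Colayered : ∀ n' bs → length bs ≡ n' → Colayered n' (colayeredVec n' bs)
  colayeredVec-Colayered n' bs e = subst (λ b → Colayered′ b) (sym (descents-colayeredVec n' bs e))
    ( InjectiveBelow-resp values≡ (colayered-injective bs (suc n'))
    , ColayeredBy-resp values≡ (colayered-ColayeredBy bs (suc n')))
    where
    Colayered′ : List Bool → Set
    Colayered′ b = InjectiveBelow (valuesℕ (colayeredVec n' bs)) (suc n') × ColayeredBy b (valuesℕ (colayeredVec n' bs)) (suc n')
    values≡ : ∀ t → t < suc n' → colayered bs (suc n') t ≡ valuesℕ (colayeredVec n' bs) t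
    values≡ t lt = sym (valuesℕ-colayeredVec n' bs t lt)

  colayeredVec-descents : ∀ n' π → Colayered n' π → colayeredVec n' (descents π) ≡ π
  colayeredVec-descents n' π (inj , col) =
    trans (sym (VP.tabulate∘lookup _)) (trans (VP.tabulate-cong entry≡) (VP.tabulate∘lookup π))
    where
    bs = descents π
    entry≡ : ∀ i → lookup (colayeredVec n' bs) i ≡ lookup π i
    entry≡ i = FP.toℕ-injective (begin
      toℕ (lookup (colayeredVec n' bs) i)      ≡⟨ extendℕ-toℕ _ i ⟨
      valuesℕ (colayeredVec n' bs) (toℕ i)     ≡⟨ valuesℕ-colayeredVec n' bs (toℕ i) (FP.toℕ<n i) ⟩
      colayered bs (suc n') (toℕ i)            ≡⟨ ColayeredBy⇒colayered bs (valuesℕ π) (suc n') inj col (valuesℕ< π) (toℕ i) (FP.toℕ<n i) ⟨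
      valuesℕ π (toℕ i)                        ≡⟨ extendℕ-toℕ _ i ⟩
      toℕ (lookup π i)                         ∎)
      where open ≡-Reasoning


-- Words with marked letters
module MarkedWords where

  open import Data.Nat using (ℕ; suc; _+_)
  import Data.Nat.Properties as NP
  open import Data.Fin as Fin using (Fin; _<_; _≤?_)
  open import Data.Fin.Properties using () renaming (_≟_ to _≟F_)
  open import Data.Bool using (Bool; true; false)
  open import Data.List using (List; [_]; []; _∷_; map; length; _++_; concat)
  open import Data.Product using (_×_; _,_; proj₁; proj₂)
  open import Data.Unit using (⊤; tt)
  open import Data.Empty using (⊥-elim)
  open import Relation.Nullary using (yes; no)
  open import Relation.Binary.PropositionalEquality hiding ([_])
  open Runs using (bit; runIndex)

  module _ {m : ℕ} where
    MarkedWord : Set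
    MarkedWord = List (Fin m × Bool)

    Compatible : Fin m → MarkedWord → Set
    Compatible p [] = ⊤
    Compatible p ((a , false) ∷ w) = p Fin.≤ a × Compatible a w
    Compatible p ((a , true) ∷ w) = p < a × Compatible a w

    ChainFrom : (Fin m → Fin m → Set) → Fin m → List (Fin m) → Set
    ChainFrom R p [] = ⊤
    ChainFrom R p (a ∷ U) = R p a × ChainFrom R a U

    WeaklyIncreasingFrom : Fin m → List (Fin m) → Set
    WeaklyIncreasingFrom = ChainFrom Fin._≤_

    StrictlyIncreasingFrom : Fin m → List (Fin m) → Set
    StrictlyIncreasingFrom = ChainFrom _<_

    unmarked : MarkedWord → List (Fin m)
    unmarked [] = []
    unmarked ((a , false) ∷ w) = a ∷ unmarked w
    unmarked ((a , true) ∷ w) = unmarked w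

    marked : MarkedWord → List (Fin m)
    marked [] = []
    marked ((a , false) ∷ w) = marked w
    marked ((a , true) ∷ w) = a ∷ marked w

    mark : Fin m → Fin m × Bool
    mark c = (c , true)
    unmark : Fin m → Fin m × Bool
    unmark c = (c , false)

    -- Each letter of C is placed just before the first letter of U that is
    -- at least as large; this is the only interleaving that is Compatible.
    mutual
      merge : List (Fin m) → List (Fin m) → MarkedWord
      merge [] C = map mark C
      merge (u ∷ U) C = merge∷ u U C

      merge∷ : Fin m → List (Fin m) → List (Fin m) → MarkedWord
      merge∷ u U [] = unmark u ∷ map unmark U
      merge∷ u U (c ∷ C) with c ≤? u
      ... | yes _ = mark c ∷ merge∷ u U C
      ... | no _ = unmark u ∷ merge U (c ∷ C)

    merge-[] : ∀ U → merge U [] ≡ map unmark U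
    merge-[] [] = refl
    merge-[] (u ∷ U) = refl

    unmarked-map-mark : ∀ C → unmarked (map mark C) ≡ []
    unmarked-map-mark [] = refl
    unmarked-map-mark (c ∷ C) = unmarked-map-mark C
    marked-map-mark : ∀ C → marked (map mark C) ≡ C
    marked-map-mark [] = refl
    marked-map-mark (c ∷ C) = cong (c ∷_) (marked-map-mark C)
    unmarked-map-unmark : ∀ C → unmarked (map unmark C) ≡ C
    unmarked-map-unmark [] = refl
    unmarked-map-unmark (c ∷ C) = cong (c ∷_) (unmarked-map-unmark C)
    marked-map-unmark : ∀ C → marked (map unmark C) ≡ []
    marked-map-unmark [] = refl
    marked-map-unmark (c ∷ C) = marked-map-unmark C

    mutual
      unmarked-merge : ∀ U C → unmarked (merge U C) ≡ U
      unmarked-merge [] C = unmarked-map-mark C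
      unmarked-merge (u ∷ U) C = unmarked-merge∷ u U C
      unmarked-merge∷ : ∀ u U C → unmarked (merge∷ u U C) ≡ u ∷ U
      unmarked-merge∷ u U [] = cong (u ∷_) (unmarked-map-unmark U)
      unmarked-merge∷ u U (c ∷ C) with c ≤? u
      ... | yes _ = unmarked-merge∷ u U C
      ... | no _ = cong (u ∷_) (unmarked-merge U (c ∷ C))

    mutual
      marked-merge : ∀ U C → marked (merge U C) ≡ C
      marked-merge [] C = marked-map-mark C
      marked-merge (u ∷ U) C = marked-merge∷ u U C
      marked-merge∷ : ∀ u U C → marked (merge∷ u U C) ≡ C
      marked-merge∷ u U [] = marked-map-unmark U
      marked-merge∷ u U (c ∷ C) with c ≤? u
      ... | yes _ = cong (c ∷_) (marked-merge∷ u U C)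
      ... | no _ = marked-merge U (c ∷ C)

    WeaklyIncreasingFrom-weaken : ∀ {p a} U → p Fin.≤ a → WeaklyIncreasingFrom a U → WeaklyIncreasingFrom p U
    WeaklyIncreasingFrom-weaken [] _ _ = tt
    WeaklyIncreasingFrom-weaken (x ∷ U) le (l , r) = NP.≤-trans le l , r
    StrictlyIncreasingFrom-weaken : ∀ {p a} C → p Fin.≤ a → StrictlyIncreasingFrom a C → StrictlyIncreasingFrom p C
    StrictlyIncreasingFrom-weaken [] _ _ = tt
    StrictlyIncreasingFrom-weaken (x ∷ C) le (l , r) = NP.≤-<-trans le l , r

    Compatible⇒split : ∀ p w → Compatible p w → WeaklyIncreasingFrom p (unmarked w) × StrictlyIncreasingFrom p (marked w)
    Compatible⇒split p [] g = tt , tt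
    Compatible⇒split p ((a , false) ∷ w) (l , g) with Compatible⇒split a w g
    ... | ws , ss = (l , ws) , StrictlyIncreasingFrom-weaken (marked w) l ss
    Compatible⇒split p ((a , true) ∷ w) (l , g) with Compatible⇒split a w g
    ... | ws , ss = WeaklyIncreasingFrom-weaken (unmarked w) (NP.<⇒≤ l) ws , (l , ss)

    Compatible-map-mark : ∀ p C → StrictlyIncreasingFrom p C → Compatible p (map mark C)
    Compatible-map-mark p [] _ = tt
    Compatible-map-mark p (c ∷ C) (l , r) = l , Compatible-map-mark c C r
    Compatible-map-unmark : ∀ p U → WeaklyIncreasingFrom p U → Compatible p (map unmark U)
    Compatible-map-unmark p [] _ = tt
    Compatible-map-unmark p (c ∷ C) (l , r) = l , Compatible-map-unmark c C r

    mutual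
      merge-Compatible : ∀ p U C → WeaklyIncreasingFrom p U → StrictlyIncreasingFrom p C → Compatible p (merge U C)
      merge-Compatible p [] C _ ss = Compatible-map-mark p C ss
      merge-Compatible p (u ∷ U) C ws ss = merge∷-Compatible p u U C ws ss
      merge∷-Compatible : ∀ p u U C → WeaklyIncreasingFrom p (u ∷ U) → StrictlyIncreasingFrom p C → Compatible p (merge∷ u U C)
      merge∷-Compatible p u U [] (l , ws) _ = l , Compatible-map-unmark u U ws
      merge∷-Compatible p u U (c ∷ C) (l , ws) (l' , ss) with c ≤? u
      ... | yes c≤u = l' , merge∷-Compatible c u U C (c≤u , ws) ss
      ... | no c≰u = l , merge-Compatible u U (c ∷ C) ws (NP.≰⇒> c≰u , ss)

    merge-mark : ∀ a U C → WeaklyIncreasingFrom a U → merge U (a ∷ C) ≡ mark a ∷ merge U C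
    merge-mark a [] C _ = refl
    merge-mark a (u ∷ U) C (l , _) with a ≤? u
    ... | yes _ = refl
    ... | no n = ⊥-elim (n l)

    merge∷-unmark : ∀ a U C → StrictlyIncreasingFrom a C → merge∷ a U C ≡ unmark a ∷ merge U C
    merge∷-unmark a U [] _ = cong (unmark a ∷_) (sym (merge-[] U))
    merge∷-unmark a U (c ∷ C) (l , _) with c ≤? a
    ... | yes y = ⊥-elim (NP.<⇒≱ l y)
    ... | no _ = refl

    merge-unmarked-marked : ∀ p w → Compatible p w → merge (unmarked w) (marked w) ≡ w
    merge-unmarked-marked p [] g = refl
    merge-unmarked-marked p ((a , false) ∷ w) (l , g) =
      trans (merge∷-unmark a (unmarked w) (marked w) (proj₂ (Compatible⇒split a w g)))
            (cong (unmark a ∷_) (merge-unmarked-marked a w g))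
    merge-unmarked-marked p ((a , true) ∷ w) (l , g) =
      trans (merge-mark a (unmarked w) (marked w) (proj₁ (Compatible⇒split a w g)))
            (cong (mark a ∷_) (merge-unmarked-marked a w g))

    countFin-++ : ∀ (a : Fin m) xs ys → countFin a (xs ++ ys) ≡ countFin a xs + countFin a ys
    countFin-++ a [] ys = refl
    countFin-++ a (x ∷ xs) ys with a ≟F x
    ... | yes _ = cong suc (countFin-++ a xs ys)
    ... | no _ = countFin-++ a xs ys

    countFin-split : ∀ (a : Fin m) w → countFin a (map proj₁ w) ≡ countFin a (unmarked w) + countFin a (marked w)
    countFin-split a [] = refl
    countFin-split a ((x , false) ∷ w) with a ≟F x
    ... | yes _ = cong suc (countFin-split a w)
    ... | no _ = countFin-split a w
    countFin-split a ((x , true) ∷ w) with a ≟F x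
    ... | yes _ = trans (cong suc (countFin-split a w)) (sym (NP.+-suc _ _))
    ... | no _ = countFin-split a w

    countFin-∷ : ∀ (a x : Fin m) xs → countFin a (x ∷ xs) ≡ countFin a [ x ] + countFin a xs
    countFin-∷ a x xs with a ≟F x
    ... | yes _ = refl
    ... | no _ = refl

    countFin-hook : ∀ (a s₀ : Fin m) w →
      countFin a (s₀ ∷ map proj₁ w) ≡ countFin a (concat ((s₀ ∷ unmarked w) ∷ map [_] (marked w)))
    countFin-hook a s₀ w = begin
      countFin a (s₀ ∷ map proj₁ w)                                 ≡⟨ countFin-∷ a s₀ _ ⟩
      #s₀ + countFin a (map proj₁ w)                                ≡⟨ cong (#s₀ +_) (countFin-split a w) ⟩
      #s₀ + (countFin a (unmarked w) + countFin a (marked w))       ≡⟨ NP.+-assoc #s₀ _ _ ⟨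
      #s₀ + countFin a (unmarked w) + countFin a (marked w)         ≡⟨ cong (_+ countFin a (marked w)) (countFin-∷ a s₀ (unmarked w)) ⟨
      countFin a (s₀ ∷ unmarked w) + countFin a (marked w)          ≡⟨ countFin-++ a (s₀ ∷ unmarked w) (marked w) ⟨
      countFin a ((s₀ ∷ unmarked w) ++ marked w)                    ≡⟨ cong (λ z → countFin a ((s₀ ∷ unmarked w) ++ z)) (concat-map-[] (marked w)) ⟨
      countFin a (concat ((s₀ ∷ unmarked w) ∷ map [_] (marked w)))  ∎
      where
      open ≡-Reasoning
      #s₀ = countFin a [ s₀ ]
      concat-map-[] : (C : List (Fin m)) → concat (map [_] C) ≡ C
      concat-map-[] [] = refl
      concat-map-[] (x ∷ C) = cong (x ∷_) (concat-map-[] C)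

    length-split : ∀ w → length (unmarked w) + length (marked w) ≡ length w
    length-split [] = refl
    length-split ((x , false) ∷ w) = cong suc (length-split w)
    length-split ((x , true) ∷ w) = trans (NP.+-suc _ _) (cong suc (length-split w))

    length-marked : ∀ w → length (marked w) ≡ runIndex (map proj₂ w) (length w)
    length-marked [] = refl
    length-marked ((x , false) ∷ w) = length-marked w
    length-marked ((x , true) ∷ w) = cong suc (length-marked w)

    length-merge : ∀ U C → length (merge U C) ≡ length U + length C
    length-merge U C = begin
      length (merge U C)                                           ≡⟨ length-split (merge U C) ⟨
      length (unmarked (merge U C)) + length (marked (merge U C))  ≡⟨ cong₂ _+_ (cong length (unmarked-merge U C))
                                                                                 (cong length (marked-merge U C)) ⟩
      length U + length C                                          ∎
      where open ≡-Reasoning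

-- Tableaux of hook shape
module HookTableaux where

  open import Data.Nat using (ℕ; zero; suc; _∸_)
  import Data.Nat.Properties as NP
  open import Data.Fin as Fin using (Fin)
  open import Data.List using (List; [_]; []; _∷_; map; length; replicate)
  open import Data.List.Properties using (∷-injectiveˡ; ∷-injectiveʳ)
  open import Data.Maybe using (just)
  open import Data.Product using (Σ; _×_; _,_)
  open import Data.Unit using (tt)
  open import Relation.Binary.PropositionalEquality hiding ([_])
  open MarkedWords

  record HookTableau {m} (n k : ℕ) (T : List (List (Fin m))) : Set where
    constructor hookTableau
    field
      corner : Fin m
      arm leg : List (Fin m)
      shape : T ≡ (corner ∷ arm) ∷ map [_] leg
      length-arm : length arm ≡ n ∸ k
      length-leg : length leg ≡ k ∸ 1
      arm-increasing : WeaklyIncreasingFrom corner arm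
      leg-increasing : StrictlyIncreasingFrom corner leg

  module _ {m : ℕ} where
    Adjacent : (Fin m → Fin m → Set) → List (Fin m) → Set
    Adjacent R xs = ∀ c a b → xs !! c ≡ just a → xs !! suc c ≡ just b → R a b

    ChainFrom⇒Adjacent : ∀ {R} p U → ChainFrom R p U → Adjacent R (p ∷ U)
    ChainFrom⇒Adjacent p (x ∷ U) (l , _) zero a b refl refl = l
    ChainFrom⇒Adjacent p (x ∷ U) (_ , w) (suc c) a b e1 e2 = ChainFrom⇒Adjacent x U w c a b e1 e2

    Adjacent⇒ChainFrom : ∀ {R} p U → Adjacent R (p ∷ U) → ChainFrom R p U
    Adjacent⇒ChainFrom p [] h = tt
    Adjacent⇒ChainFrom p (x ∷ U) h = h 0 p x refl refl , Adjacent⇒ChainFrom x U (λ c a b → h (suc c) a b)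

    map-[]-!! : ∀ (C : List (Fin m)) r row → map [_] C !! r ≡ just row → Σ (Fin m) λ x → row ≡ x ∷ [] × C !! r ≡ just x
    map-[]-!! (x ∷ C) zero row refl = x , refl , refl
    map-[]-!! (x ∷ C) (suc r) row e = map-[]-!! C r row e

    !!-map-[] : ∀ (C : List (Fin m)) r x → C !! r ≡ just x → map [_] C !! r ≡ just (x ∷ [])
    !!-map-[] (y ∷ C) zero x refl = refl
    !!-map-[] (y ∷ C) (suc r) x e = !!-map-[] C r x e

    length≡1⇒singletons : ∀ j (R : List (List (Fin m))) → map length R ≡ replicate j 1 →
      Σ (List (Fin m)) λ C → R ≡ map [_] C × length C ≡ j
    length≡1⇒singletons zero [] e = [] , refl , refl
    length≡1⇒singletons (suc j) ((x ∷ []) ∷ R) e with length≡1⇒singletons j R (∷-injectiveʳ e)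
    ... | C , e1 , e2 = x ∷ C , cong ((x ∷ []) ∷_) e1 , cong suc e2

    map-length-singletons : ∀ (C : List (Fin m)) → map length (map [_] C) ≡ replicate (length C) 1
    map-length-singletons [] = refl
    map-length-singletons (x ∷ C) = cong (1 ∷_) (map-length-singletons C)

    HookTableau⇒IsSSYT : ∀ n k (T : List (List (Fin m))) → HookTableau n k T → IsSSYT (hook n k) T
    HookTableau⇒IsSSYT n k T (hookTableau r₀ U C refl lU lC ws ss) = shape , rows , cols
      where
      shape : map length ((r₀ ∷ U) ∷ map [_] C) ≡ hook n k
      shape = cong₂ _∷_ (cong suc lU) (trans (map-length-singletons C) (cong (λ z → replicate z 1) lC))
      rows : ∀ r c (row : List (Fin m)) (a b : Fin m) → ((r₀ ∷ U) ∷ map [_] C) !! r ≡ just row →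
         row !! c ≡ just a → row !! suc c ≡ just b → a Fin.≤ b
      rows zero c row a b refl e1 e2 = ChainFrom⇒Adjacent r₀ U ws c a b e1 e2
      rows (suc r) c row a b e e1 e2 with map-[]-!! C r row e
      rows (suc r) zero .(x ∷ []) a b e e1 () | x , refl , _
      rows (suc r) (suc c) .(x ∷ []) a b e () e2 | x , refl , _
      cols : ∀ r c (row row' : List (Fin m)) (a b : Fin m) → ((r₀ ∷ U) ∷ map [_] C) !! r ≡ just row →
         ((r₀ ∷ U) ∷ map [_] C) !! suc r ≡ just row' → row !! c ≡ just a → row' !! c ≡ just b → a Fin.< b
      cols r c row row' a b e e' e1 e2 with map-[]-!! C r row' e'
      cols r (suc c) row .(y ∷ []) a b e e' e1 () | y , refl , ey
      cols zero zero row .(y ∷ []) a b refl e' refl refl | y , refl , ey = ChainFrom⇒Adjacent r₀ C ss 0 r₀ y refl ey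
      cols (suc r) zero row .(y ∷ []) a b e e' e1 refl | y , refl , ey with map-[]-!! C r row e
      cols (suc r) zero .(x ∷ []) .(y ∷ []) a b e e' refl refl | y , refl , ey | x , refl , ex = ChainFrom⇒Adjacent r₀ C ss (suc r) x y ex ey

    IsSSYT⇒HookTableau : ∀ n k (T : List (List (Fin m))) → IsSSYT (hook n k) T → HookTableau n k T
    IsSSYT⇒HookTableau n k ((r₀ ∷ U) ∷ R) (shape , rows , cols) with length≡1⇒singletons (k ∸ 1) R (∷-injectiveʳ shape)
    ... | C , refl , lC = hookTableau r₀ U C refl (NP.suc-injective (∷-injectiveˡ shape)) lC
         (Adjacent⇒ChainFrom r₀ U (λ c a b e1 e2 → rows 0 c (r₀ ∷ U) a b refl e1 e2))
         (Adjacent⇒ChainFrom r₀ C firstColumn)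
      where
      firstColumn : Adjacent Fin._<_ (r₀ ∷ C)
      firstColumn zero a b refl e2 = cols 0 0 (r₀ ∷ U) (b ∷ []) r₀ b refl (!!-map-[] C 0 b e2) refl refl
      firstColumn (suc c) a b e1 e2 = cols (suc c) 0 (a ∷ []) (b ∷ []) a b (!!-map-[] C c a e1) (!!-map-[] C (suc c) b e2) refl refl

-- Words compatible with the descents of a permutation
module DescentWords where

  open import Data.Nat
  open import Data.Nat.Properties
  open import Data.Fin as Fin using (Fin; toℕ; fromℕ<)
  import Data.Fin.Properties as FP
  open import Data.Bool using (Bool; true; false)
  open import Data.List using (List; []; _∷_; length; zip)
  open import Data.Vec using (Vec; []; _∷_; lookup; toList)
  import Data.Vec.Properties as VP
  open import Data.Product using (_×_; _,_; proj₁; proj₂)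
  open import Data.Unit using (tt)
  open import Relation.Nullary.Decidable using (dec-true)
  open import Relation.Binary.PropositionalEquality
  open Runs
  open ColayeredClass
  open MarkedWords

  lookupℕ : ∀ {m} → List (Fin m) → ℕ → ℕ
  lookupℕ [] _ = 0
  lookupℕ (x ∷ xs) zero = toℕ x
  lookupℕ (x ∷ xs) (suc t) = lookupℕ xs t

  lookupℕ-toList : ∀ {m N} (v : Vec (Fin m) N) i → lookupℕ (toList v) (toℕ i) ≡ toℕ (lookup v i)
  lookupℕ-toList (x ∷ v) Fin.zero = refl
  lookupℕ-toList (x ∷ v) (Fin.suc i) = lookupℕ-toList v i

  -- The index-wise form of Compatible p (zip xs bs).
  StepCompatible : ∀ {m} → Fin m → List (Fin m) → List Bool → Set
  StepCompatible p xs bs = ∀ t → t < length xs →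
    (lookupℕ (p ∷ xs) t ≤ lookupℕ (p ∷ xs) (suc t)) ×
    (markAt bs t ≡ true → lookupℕ (p ∷ xs) t < lookupℕ (p ∷ xs) (suc t))

  Compatible⇒StepCompatible : ∀ {m} (p : Fin m) xs bs → length xs ≡ length bs →
    Compatible p (zip xs bs) → StepCompatible p xs bs
  Compatible⇒StepCompatible p (x ∷ xs) (false ∷ bs) e (l , g) zero _ = l , λ ()
  Compatible⇒StepCompatible p (x ∷ xs) (true ∷ bs) e (l , g) zero _ = <⇒≤ l , λ _ → l
  Compatible⇒StepCompatible p (x ∷ xs) (false ∷ bs) e (_ , g) (suc t) (s≤s lt) =
    Compatible⇒StepCompatible x xs bs (suc-injective e) g t lt
  Compatible⇒StepCompatible p (x ∷ xs) (true ∷ bs) e (_ , g) (suc t) (s≤s lt) =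
    Compatible⇒StepCompatible x xs bs (suc-injective e) g t lt

  StepCompatible⇒Compatible : ∀ {m} (p : Fin m) xs bs → length xs ≡ length bs →
    StepCompatible p xs bs → Compatible p (zip xs bs)
  StepCompatible⇒Compatible p [] [] e h = tt
  StepCompatible⇒Compatible p (x ∷ xs) (false ∷ bs) e h =
    proj₁ (h 0 (s≤s z≤n)) , StepCompatible⇒Compatible x xs bs (suc-injective e) (λ t lt → h (suc t) (s≤s lt))
  StepCompatible⇒Compatible p (x ∷ xs) (true ∷ bs) e h =
    proj₂ (h 0 (s≤s z≤n)) refl , StepCompatible⇒Compatible x xs bs (suc-injective e) (λ t lt → h (suc t) (s≤s lt))

  module DesCompatibility {m n'} (π : Vec (Fin (suc n')) (suc n')) (s₀ : Fin m) (s' : Vec (Fin m) n') where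
    s : Vec (Fin m) (suc n')
    s = s₀ ∷ s'
    xs = toList s'
    bs = descents π
    length-xs : length xs ≡ n'
    length-xs = VP.length-toList s'
    length-xs≡length-bs : length xs ≡ length bs
    length-xs≡length-bs = trans length-xs (sym (length-descentMarks _ n'))

    DesCompatible⇒StepCompatible : DesCompatible π s → StepCompatible s₀ xs bs
    DesCompatible⇒StepCompatible dc t t<len =
      subst₂ _≤_ (sym s-at-i) (sym s-at-j) (proj₁ step) ,
      λ m → subst₂ _<_ (sym s-at-i) (sym s-at-j) (proj₂ step (marked⇒descent m))
      where
      t<n' : t < n'
      t<n' = subst (t <_) length-xs t<len
      i = fromℕ< (m<n⇒m<1+n t<n')
      j = fromℕ< (s≤s t<n')
      step : (lookup s i Fin.≤ lookup s j) × (lookup π j Fin.< lookup π i → lookup s i Fin.< lookup s j)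
      step = dc i j (trans (FP.toℕ-fromℕ< (s≤s t<n')) (cong suc (sym (FP.toℕ-fromℕ< (m<n⇒m<1+n t<n')))))
      s-at-i : lookupℕ (s₀ ∷ xs) t ≡ toℕ (lookup s i)
      s-at-i = trans (cong (lookupℕ (toList s)) (sym (FP.toℕ-fromℕ< (m<n⇒m<1+n t<n')))) (lookupℕ-toList s i)
      s-at-j : lookupℕ (s₀ ∷ xs) (suc t) ≡ toℕ (lookup s j)
      s-at-j = trans (cong (lookupℕ (toList s)) (sym (FP.toℕ-fromℕ< (s≤s t<n')))) (lookupℕ-toList s j)
      marked⇒descent : markAt bs t ≡ true → lookup π j Fin.< lookup π i
      marked⇒descent m = subst₂ _<_ (extendℕ-< _ _ (s≤s t<n')) (extendℕ-< _ _ (m<n⇒m<1+n t<n'))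
        (does≡true⇒ (valuesℕ π (suc t) <? valuesℕ π t) (trans (sym (markAt-descentMarks (valuesℕ π) n' t t<n')) m))

    StepCompatible⇒DesCompatible : StepCompatible s₀ xs bs → DesCompatible π s
    StepCompatible⇒DesCompatible sc i j j≡i+1 =
      subst₂ _≤_ s-at-i s-at-j (proj₁ step) , λ des → subst₂ _<_ s-at-i s-at-j (proj₂ step (descent⇒marked des))
      where
      t = toℕ i
      t<n' : t < n'
      t<n' = ≤-pred (subst (_< suc n') j≡i+1 (FP.toℕ<n j))
      step : (lookupℕ (s₀ ∷ xs) t ≤ lookupℕ (s₀ ∷ xs) (suc t)) ×
             (markAt bs t ≡ true → lookupℕ (s₀ ∷ xs) t < lookupℕ (s₀ ∷ xs) (suc t))
      step = sc t (subst (t <_) (sym length-xs) t<n')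
      s-at-i : lookupℕ (s₀ ∷ xs) t ≡ toℕ (lookup s i)
      s-at-i = lookupℕ-toList s i
      s-at-j : lookupℕ (s₀ ∷ xs) (suc t) ≡ toℕ (lookup s j)
      s-at-j = trans (cong (lookupℕ (toList s)) (sym j≡i+1)) (lookupℕ-toList s j)
      descent⇒marked : lookup π j Fin.< lookup π i → markAt bs t ≡ true
      descent⇒marked des = trans (markAt-descentMarks _ n' t t<n') (dec-true (valuesℕ π (suc t) <? valuesℕ π t)
        (subst₂ _<_ (trans (sym (extendℕ-toℕ _ j)) (cong (valuesℕ π) j≡i+1)) (sym (extendℕ-toℕ _ i)) des))

    DesCompatible⇒Compatible : DesCompatible π s → Compatible s₀ (zip xs bs)
    DesCompatible⇒Compatible dc =
      StepCompatible⇒Compatible s₀ xs bs length-xs≡length-bs (DesCompatible⇒StepCompatible dc)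

    Compatible⇒DesCompatible : Compatible s₀ (zip xs bs) → DesCompatible π s
    Compatible⇒DesCompatible g =
      StepCompatible⇒DesCompatible (Compatible⇒StepCompatible s₀ xs bs length-xs≡length-bs g)

-- Cardinalities of finite sets
module FiniteCardinality where

  open import Data.Nat using (ℕ; zero; suc)
  open import Data.Fin using (Fin)
  open import Data.List using (List; []; _∷_; map; length; filter; cartesianProductWith; cartesianProduct; allFin)
  open import Data.List.Properties using (length-map)
  open import Data.Vec using (Vec; []; _∷_)
  import Data.Vec.Properties as VP
  open import Data.Product using (Σ; _×_; _,_; proj₂)
  open import Data.List.Relation.Unary.All as All using (All; []; _∷_)
  open import Data.List.Relation.Unary.AllPairs using (AllPairs; []; _∷_)
  import Data.List.Relation.Unary.AllPairs.Properties as AllPairs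
  open import Data.List.Relation.Unary.Unique.Propositional using (Unique)
  import Data.List.Relation.Unary.Unique.Propositional.Properties as Unique
  open import Data.List.Membership.Propositional using (_∈_)
  import Data.List.Membership.Propositional.Properties as ∈
  open import Data.List.Relation.Unary.Any using (here)
  open import Relation.Unary using (Decidable)
  open import Relation.Binary.PropositionalEquality
  open import Function.Bundles using (_⇔_; mk⇔; Equivalence)
  open import Defs using (HasCard)

  record Enumeration (X : Set) : Set where
    field
      elements : List X
      unique : Unique elements
      complete : ∀ x → x ∈ elements

  open Enumeration

  Fin-enumeration : ∀ n → Enumeration (Fin n)
  Fin-enumeration n = record { elements = allFin n ; unique = Unique.allFin⁺ n ; complete = ∈.∈-allFin }

  ×-enumeration : ∀ {A B : Set} → Enumeration A → Enumeration B → Enumeration (A × B)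
  ×-enumeration EA EB = record
    { elements = cartesianProduct (elements EA) (elements EB)
    ; unique = Unique.cartesianProduct⁺ (unique EA) (unique EB)
    ; complete = λ { (a , b) → ∈.∈-cartesianProduct⁺ (complete EA a) (complete EB b) }
    }

  Vec-enumeration : ∀ {A : Set} → Enumeration A → ∀ n → Enumeration (Vec A n)
  Vec-enumeration EA zero = record { elements = [] ∷ [] ; unique = [] ∷ [] ; complete = λ { [] → here refl } }
  Vec-enumeration EA (suc n) = record
    { elements = cartesianProductWith _∷_ (elements EA) (elements EV)
    ; unique = Unique.cartesianProductWith⁺ _∷_ VP.∷-injective (unique EA) (unique EV)
    ; complete = λ { (a ∷ v) → ∈.∈-cartesianProductWith⁺ _∷_ (complete EA a) (complete EV v) }
    }
    where EV = Vec-enumeration EA n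

  HasCard-decidable : ∀ {X : Set} {P : X → Set} → Enumeration X → Decidable P → Σ ℕ (HasCard P)
  HasCard-decidable {P = P} EX P? =
    length selected , selected , Unique.filter⁺ P? {elements EX} (unique EX) ,
    (λ x → mk⇔ (∈.∈-filter⁺ P? (complete EX x)) (λ x∈ → proj₂ (∈.∈-filter⁻ P? {xs = elements EX} x∈))) , refl
    where
    selected = filter P? (elements EX)

  Unique-map : ∀ {X Y : Set} {P : X → Set} (f : X → Y) → (∀ x y → P x → P y → f x ≡ f y → x ≡ y) →
    ∀ {xs} → All P xs → Unique xs → Unique (map f xs)
  Unique-map {P = P} f inj ps u = AllPairs.map⁺ (distinctImages ps u)
    where
    distinctImages : ∀ {xs} → All P xs → Unique xs → AllPairs (λ x y → f x ≢ f y) xs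
    distinctImages [] [] = []
    distinctImages (px ∷ ps) (ux ∷ us) =
      All.zipWith (λ { (py , ne) e → ne (inj _ _ px py e) }) (ps , ux) ∷ distinctImages ps us

  HasCard-transfer : ∀ {X Y : Set} {P : X → Set} {Q : Y → Set} {c} (f : X → Y) →
    (∀ x → P x → Q (f x)) →
    (∀ x y → P x → P y → f x ≡ f y → x ≡ y) →
    (∀ y → Q y → Σ X λ x → P x × f x ≡ y) →
    HasCard P c → HasCard Q c
  HasCard-transfer {P = P} {Q} f sound inj surj (L , u , mem , len) =
    map f L , Unique-map f inj allP u , mem′ , trans (length-map f L) len
    where
    allP : All P L
    allP = All.tabulate (λ {x} x∈L → Equivalence.from (mem x) x∈L)
    mem′ : ∀ y → Q y ⇔ (y ∈ map f L)
    mem′ y = mk⇔ to from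
      where
      to : Q y → y ∈ map f L
      to q with surj y q
      ... | x , px , refl = ∈.∈-map⁺ f (Equivalence.to (mem x) px)
      from : y ∈ map f L → Q y
      from y∈ with ∈.∈-map⁻ f y∈
      ... | x , x∈L , refl = sound x (Equivalence.from (mem x) x∈L)

-- The bijection with hook tableaux
module HookBijection where

  open import Data.Nat
  open import Data.Nat.Properties
  open import Data.Fin as Fin using (Fin; toℕ)
  import Data.Fin.Properties as FP
  open import Data.Bool using (Bool)
  open import Data.List using (List; [_]; []; _∷_; map; length; zip; concat)
  open import Data.List.Properties using (length-map; map-injective; ∷-injectiveˡ; ∷-injectiveʳ)
  open import Data.Vec using (Vec; []; _∷_; lookup; toList)
  import Data.Vec.Properties as VP
  open import Data.Product using (Σ; _×_; _,_; proj₁; proj₂)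
  open import Relation.Nullary using (¬_; Dec)
  open import Relation.Nullary.Decidable using (_×-dec_; _→-dec_; map′)
  open import Relation.Binary.PropositionalEquality hiding ([_])
  open Runs
  open ColayeredClass
  open MarkedWords
  open HookTableaux
  open DescentWords
  open FiniteCardinality

  module _ {A B : Set} where
    map-proj₁-zip : ∀ (xs : List A) (ys : List B) → length xs ≡ length ys → map proj₁ (zip xs ys) ≡ xs
    map-proj₁-zip [] [] _ = refl
    map-proj₁-zip (x ∷ xs) (y ∷ ys) e = cong (x ∷_) (map-proj₁-zip xs ys (suc-injective e))

    map-proj₂-zip : ∀ (xs : List A) (ys : List B) → length xs ≡ length ys → map proj₂ (zip xs ys) ≡ ys
    map-proj₂-zip [] [] _ = refl
    map-proj₂-zip (x ∷ xs) (y ∷ ys) e = cong (y ∷_) (map-proj₂-zip xs ys (suc-injective e))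

    zip-map-proj : ∀ (w : List (A × B)) → zip (map proj₁ w) (map proj₂ w) ≡ w
    zip-map-proj [] = refl
    zip-map-proj ((x , y) ∷ w) = cong ((x , y) ∷_) (zip-map-proj w)

  padVec : ∀ {A : Set} → A → (N : ℕ) → List A → Vec A N
  padVec d zero _ = []
  padVec d (suc N) [] = d ∷ padVec d N []
  padVec d (suc N) (x ∷ xs) = x ∷ padVec d N xs

  toList-padVec : ∀ {A : Set} (d : A) N xs → length xs ≡ N → toList (padVec d N xs) ≡ xs
  toList-padVec d zero [] e = refl
  toList-padVec d (suc N) (x ∷ xs) e = cong (x ∷_) (toList-padVec d N xs (suc-injective e))

  padVec-toList : ∀ {A : Set} (d : A) N (v : Vec A N) → padVec d N (toList v) ≡ v
  padVec-toList d zero [] = refl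
  padVec-toList d (suc N) (x ∷ v) = cong (x ∷_) (padVec-toList d N v)

  DesCompatible? : ∀ {n m} (π : Vec (Fin n) n) (s : Vec (Fin m) n) → Dec (DesCompatible π s)
  DesCompatible? π s = FP.all? λ i → FP.all? λ j →
    (toℕ j ≟ suc (toℕ i)) →-dec
    ((lookup s i Fin.≤? lookup s j) ×-dec ((lookup π j Fin.<? lookup π i) →-dec (lookup s i Fin.<? lookup s j)))

  HasContent? : ∀ {m} (xs : List (Fin m)) α → Dec (HasContent xs α)
  HasContent? xs α = FP.all? (λ a → countFin a xs ≟ α a)

  arm-length : ∀ a b n' k → 1 ≤ k → a + b ≡ n' → b ≡ k ∸ 1 → a ≡ suc n' ∸ k
  arm-length a b n' (suc k) _ e refl = sym (trans (cong (_∸ k) (sym e)) (m+n∸n≡m a k))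

  hook-size : ∀ n' k → 1 ≤ k → k ≤ suc n' → (suc n' ∸ k) + (k ∸ 1) ≡ n'
  hook-size n' (suc k) _ (s≤s le) = m∸n+n≡m le

  module Bijection (n' k m : ℕ) (α : Fin m → ℕ) (1≤k : 1 ≤ k) (k≤n : k ≤ suc n') where
    n = suc n'

    Term : Set
    Term = Vec (Fin n) n × Vec (Fin m) n

    QTerm : Term → Set
    QTerm = QTerms n (λ π → Y k n π × ¬ Y (k ∸ 1) n π) m α

    STerm : List (List (Fin m)) → Set
    STerm = STerms (hook n k) m α

    descentWord : Vec (Fin n) n → Vec (Fin m) n' → List (Fin m × Bool)
    descentWord π s' = zip (toList s') (descents π)

    module _ (π : Vec (Fin n) n) (s' : Vec (Fin m) n') where
      length-toList≡length-descents : length (toList s') ≡ length (descents π)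
      length-toList≡length-descents = trans (VP.length-toList s') (sym (length-descentMarks (valuesℕ π) n'))

      map-proj₁-descentWord : map proj₁ (descentWord π s') ≡ toList s'
      map-proj₁-descentWord = map-proj₁-zip (toList s') (descents π) length-toList≡length-descents

      map-proj₂-descentWord : map proj₂ (descentWord π s') ≡ descents π
      map-proj₂-descentWord = map-proj₂-zip (toList s') (descents π) length-toList≡length-descents

      length-descentWord : length (descentWord π s') ≡ n'
      length-descentWord =
        trans (sym (length-map proj₁ (descentWord π s'))) (trans (cong length map-proj₁-descentWord) (VP.length-toList s'))

    toTableau : Term → List (List (Fin m))
    toTableau (π , s₀ ∷ s') = (s₀ ∷ unmarked w) ∷ map [_] (marked w)
      where w = descentWord π s'

    fromHook : Fin m → List (Fin m) → List (Fin m) → Term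
    fromHook c U C = colayeredVec n' (map proj₂ w) , c ∷ padVec c n' (map proj₁ w)
      where w = merge U C

    toTableau-STerm : ∀ x → QTerm x → STerm (toTableau x)
    toTableau-STerm (π , s₀ ∷ s') (y , dc , hc) =
      HookTableau⇒IsSSYT n k _ (hookTableau s₀ (unmarked w) (marked w) refl length-arm length-leg
                                            (proj₁ increasing) (proj₂ increasing)) ,
      content
      where
      w = descentWord π s'
      increasing : WeaklyIncreasingFrom s₀ (unmarked w) × StrictlyIncreasingFrom s₀ (marked w)
      increasing = Compatible⇒split s₀ w (DesCompatibility.DesCompatible⇒Compatible π s₀ s' dc)
      length-leg : length (marked w) ≡ k ∸ 1
      length-leg = begin
        length (marked w)                      ≡⟨ length-marked w ⟩
        runIndex (map proj₂ w) (length w)      ≡⟨ cong₂ runIndex (map-proj₂-descentWord π s') (length-descentWord π s') ⟩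
        numDescents π                          ≡⟨ proj₂ (Ydiff⇒ExactlyColayered k n' π 1≤k y) ⟩
        k ∸ 1                                  ∎
        where open ≡-Reasoning
      length-arm : length (unmarked w) ≡ n ∸ k
      length-arm = arm-length _ _ n' k 1≤k (trans (length-split w) (length-descentWord π s')) length-leg
      content : HasContent (concat ((s₀ ∷ unmarked w) ∷ map [_] (marked w))) α
      content a = trans (sym (countFin-hook a s₀ w))
        (trans (cong (λ z → countFin a (s₀ ∷ z)) (map-proj₁-descentWord π s')) (hc a))

    fromHook-toTableau : ∀ π s₀ s' → QTerm (π , s₀ ∷ s') →
      fromHook s₀ (unmarked (descentWord π s')) (marked (descentWord π s')) ≡ (π , s₀ ∷ s')
    fromHook-toTableau π s₀ s' (y , dc , _) = begin
      fromHook s₀ (unmarked w) (marked w)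
        ≡⟨ cong (λ z → colayeredVec n' (map proj₂ z) , s₀ ∷ padVec s₀ n' (map proj₁ z)) (merge-unmarked-marked s₀ w compatible) ⟩
      (colayeredVec n' (map proj₂ w) , s₀ ∷ padVec s₀ n' (map proj₁ w))
        ≡⟨ cong₂ (λ b xs → colayeredVec n' b , s₀ ∷ padVec s₀ n' xs) (map-proj₂-descentWord π s') (map-proj₁-descentWord π s') ⟩
      (colayeredVec n' (descents π) , s₀ ∷ padVec s₀ n' (toList s'))
        ≡⟨ cong₂ (λ σ v → σ , s₀ ∷ v) (colayeredVec-descents n' π (proj₁ (Ydiff⇒ExactlyColayered k n' π 1≤k y))) (padVec-toList s₀ n' s') ⟩
      (π , s₀ ∷ s')  ∎
      where
      open ≡-Reasoning
      w = descentWord π s'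
      compatible : Compatible s₀ w
      compatible = DesCompatibility.DesCompatible⇒Compatible π s₀ s' dc

    toTableau-injective : ∀ x x' → QTerm x → QTerm x' → toTableau x ≡ toTableau x' → x ≡ x'
    toTableau-injective (π , s₀ ∷ s') (π' , s₀' ∷ s'') q q' e = begin
      (π , s₀ ∷ s')                                                     ≡⟨ fromHook-toTableau π s₀ s' q ⟨
      fromHook s₀ (unmarked w) (marked w)                               ≡⟨ cong (λ c → fromHook c (unmarked w) (marked w)) corner≡ ⟩
      fromHook s₀' (unmarked w) (marked w)                              ≡⟨ cong₂ (fromHook s₀') arm≡ leg≡ ⟩
      fromHook s₀' (unmarked w') (marked w')                            ≡⟨ fromHook-toTableau π' s₀' s'' q' ⟩
      (π' , s₀' ∷ s'')                                                  ∎
      where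
      open ≡-Reasoning
      w = descentWord π s'
      w' = descentWord π' s''
      row≡ : s₀ ∷ unmarked w ≡ s₀' ∷ unmarked w'
      row≡ = ∷-injectiveˡ e
      corner≡ : s₀ ≡ s₀'
      corner≡ = ∷-injectiveˡ row≡
      arm≡ : unmarked w ≡ unmarked w'
      arm≡ = ∷-injectiveʳ row≡
      leg≡ : marked w ≡ marked w'
      leg≡ = map-injective ∷-injectiveˡ (∷-injectiveʳ e)

    module FromHook (c : Fin m) (U C : List (Fin m)) (length-U : length U ≡ n ∸ k) (length-C : length C ≡ k ∸ 1)
                    (U-increasing : WeaklyIncreasingFrom c U) (C-increasing : StrictlyIncreasingFrom c C) where
      w = merge U C
      bs = map proj₂ w
      π : Vec (Fin n) n
      π = colayeredVec n' bs
      s' : Vec (Fin m) n'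
      s' = padVec c n' (map proj₁ w)

      length-w : length w ≡ n'
      length-w = trans (length-merge U C) (trans (cong₂ _+_ length-U length-C) (hook-size n' k 1≤k k≤n))

      descents≡ : descents π ≡ bs
      descents≡ = descents-colayeredVec n' bs (trans (length-map proj₂ w) length-w)

      toList-s' : toList s' ≡ map proj₁ w
      toList-s' = toList-padVec c n' (map proj₁ w) (trans (length-map proj₁ w) length-w)

      descentWord≡ : descentWord π s' ≡ w
      descentWord≡ = trans (cong₂ zip toList-s' descents≡) (zip-map-proj w)

      toTableau-fromHook : toTableau (fromHook c U C) ≡ (c ∷ U) ∷ map [_] C
      toTableau-fromHook = trans (cong (λ z → (c ∷ unmarked z) ∷ map [_] (marked z)) descentWord≡)
                                 (cong₂ (λ a b → (c ∷ a) ∷ map [_] b) (unmarked-merge U C) (marked-merge U C))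

      exactlyColayered : ExactlyColayered k n' π
      exactlyColayered = colayeredVec-Colayered n' bs (trans (length-map proj₂ w) length-w) , (begin
        runIndex (descents π) n'             ≡⟨ cong₂ runIndex descents≡ (sym length-w) ⟩
        runIndex (map proj₂ w) (length w)    ≡⟨ length-marked w ⟨
        length (marked w)                    ≡⟨ cong length (marked-merge U C) ⟩
        length C                             ≡⟨ length-C ⟩
        k ∸ 1                                ∎)
        where open ≡-Reasoning

      fromHook-QTerm : HasContent (concat ((c ∷ U) ∷ map [_] C)) α → QTerm (fromHook c U C)
      fromHook-QTerm content =
        ExactlyColayered⇒Ydiff k n' π 1≤k exactlyColayered ,
        DesCompatibility.Compatible⇒DesCompatible π c s' (subst (Compatible c) (sym descentWord≡) (merge-Compatible c U C U-increasing C-increasing)) ,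
        λ a → begin
          countFin a (c ∷ toList s')                                    ≡⟨ cong (λ z → countFin a (c ∷ z)) toList-s' ⟩
          countFin a (c ∷ map proj₁ w)                                  ≡⟨ countFin-hook a c w ⟩
          countFin a (concat ((c ∷ unmarked w) ∷ map [_] (marked w)))   ≡⟨ cong₂ (λ x y → countFin a (concat ((c ∷ x) ∷ map [_] y)))
                                                                                  (unmarked-merge U C) (marked-merge U C) ⟩
          countFin a (concat ((c ∷ U) ∷ map [_] C))                     ≡⟨ content a ⟩
          α a                                                           ∎
        where open ≡-Reasoning

    toTableau-surjective : ∀ T → STerm T → Σ Term λ x → QTerm x × toTableau x ≡ T
    toTableau-surjective T (ssyt , content) with IsSSYT⇒HookTableau n k T ssyt
    ... | hookTableau c U C refl length-U length-C U-increasing C-increasing =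
      fromHook c U C , fromHook-QTerm content , toTableau-fromHook
      where open FromHook c U C length-U length-C U-increasing C-increasing

    QTerm? : ∀ x → Dec (QTerm x)
    QTerm? (π , s) =
      map′ (λ (e , dc , hc) → ExactlyColayered⇒Ydiff k n' π 1≤k e , dc , hc)
           (λ (y , dc , hc) → Ydiff⇒ExactlyColayered k n' π 1≤k y , dc , hc)
           (ExactlyColayered? k n' π ×-dec DesCompatible? π s ×-dec HasContent? (toList s) α)

    QTerm-HasCard : Σ ℕ (HasCard QTerm)
    QTerm-HasCard = HasCard-decidable
      (×-enumeration (Vec-enumeration (Fin-enumeration n) n) (Vec-enumeration (Fin-enumeration m) n)) QTerm?

proposition4p12 : (n k : ℕ) → 1 ≤ k → k ≤ n → (m : ℕ) → (α : Fin m → ℕ) →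
    Σ ℕ λ c →
      HasCard (QTerms n (λ π → Y k n π × ¬ Y (k ∸ 1) n π) m α) c ×
      HasCard (STerms (hook n k) m α) c
proposition4p12 zero (suc k) _ () m α
proposition4p12 (suc n') k 1≤k k≤n m α =
  proj₁ QTerm-HasCard , terms ,
  HasCard-transfer toTableau toTableau-STerm toTableau-injective toTableau-surjective terms
  where
  open HookBijection.Bijection n' k m α 1≤k k≤n
  open FiniteCardinality using (HasCard-transfer)
  terms : HasCard QTerm (proj₁ QTerm-HasCard)
  terms = proj₂ QTerm-HasCard
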